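{- Let $\mathbf{a}=(a_1,\ldots,a_n)$ be a weak composition of length $n$. Then the key polynomial $\kappa_{\mathbf{a}}$ is quasisymmetric in $x_1,\ldots,x_n$ if and only if $\mathbf{a}$ has no zero parts or the parts of $\mathbf{a}$ are weakly increasing ($a_1\le a_2\le\cdots\le a_n$).
   Context: A weak composition is a finite sequence $\mathbf{a}=(a_1,\ldots,a_n)$ of nonnegative integers. A diagram is a finite set of cells $(c,r)$ with $c,r$ positive integers; $c$ is the column and $r$ the row (rows numbered from the bottom). A labeled diagram assigns a positive integer label to each cell; its weight $\mathrm{wt}(T)$ is the weak composition whose $r$-th part is the number of cells in row $r$, and $x^{\mathrm{wt}(T)}=\prod_r x_r^{\mathrm{wt}(T)_r}$. A key Kohnert tableau of content $\mathbf{a}$ is a labeled diagram with labels $1^{a_1},2^{a_2},\ldots,n^{a_n}$ (one per cell) such that: (1) for each $i$ there is exactly one cell labeled $i$ in each of the columns $1,\ldots,a_i$; (2) every label in row $r$ is at least $r$; (3) the cells labeled $i$ weakly descend (in row index) from left to right; (4) if labels $i<j$ appear in the same column with $i$ above $j$, then there is a cell labeled $i$ in the column immediately to the right, strictly above the row of that $j$. Let $\mathrm{KKT}(\mathbf{a})$ be the set of these; the key polynomial is $\kappa_{\mathbf{a}}=\sum_{T\in\mathrm{KKT}(\mathbf{a})}x^{\mathrm{wt}(T)}$. A polynomial in $x_1,\ldots,x_n$ is quasisymmetric if for all positive integers $b_1,\ldots,b_k$ and all $i_1<\cdots<i_k$, $j_1<\cdots<j_k$, the coefficients of $x_{i_1}^{b_1}\cdots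 x_{i_k}^{b_k}$ and $x_{j_1}^{b_1}\cdots x_{j_k}^{b_k}$ agree. -}

module Defs where

open import Data.Nat using (ℕ; zero; suc; _+_; _∸_; _⊓_; _≡ᵇ_; _<ᵇ_; _≤_; _<_)
open import Data.Nat.Properties using ()
open import Data.Bool using (Bool; true; false; _∧_; _∨_; not; if_then_else_)
open import Data.List using (List; []; _∷_; map; concatMap; upTo; length; filter; foldr)
open import Data.Nat.ListAction using (sum)
import Data.List as L
open import Data.Vec using (Vec; lookup; toList; tabulate; replicate; _[_]≔_)
import Data.Vec as V
open import Data.Fin using (Fin; toℕ)
import Data.Fin as F
open import Relation.Binary.PropositionalEquality using (_≡_)
open import Relation.Nullary.Decidable using (T?)

-- Encoding of a labeled diagram with content a = (a_1,...,a_n) that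
-- satisfies condition (1): for each label i there is exactly one cell
-- labeled i in each column 1..a_i (and no other cells labeled i, since
-- the labels are exactly 1^{a_1} ... n^{a_n}).  Such a diagram is a list
-- (indexed by the label i = 1..n) of lists (indexed by the column
-- c = 1..a_i) giving the row of the cell labeled i in column c.
-- Rows are 1-indexed; we enumerate rows in 1..n, which loses nothing
-- because condition (2) forces row ≤ label ≤ n.

Filling : Set
Filling = List (List ℕ)

range : ℕ → List ℕ
range n = map suc (upTo n)

words : ℕ → ℕ → List (List ℕ)
words n zero    = [] ∷ []
words n (suc k) = concatMap (λ r → map (r ∷_) (words n k)) (range n)

fillings : ℕ → List ℕ → List Filling
fillings n []       = [] ∷ []
fillings n (a ∷ as) = concatMap (λ w → map (w ∷_) (fillings n as)) (words n a)

-- 1-indexed list access, 0 if absent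
at : List ℕ → ℕ → ℕ
at []       _             = 0
at (x ∷ xs) zero          = 0
at (x ∷ xs) (suc zero)    = x
at (x ∷ xs) (suc (suc k)) = at xs (suc k)

atL : Filling → ℕ → List ℕ
atL []       _             = []
atL (x ∷ xs) zero          = []
atL (x ∷ xs) (suc zero)    = x
atL (x ∷ xs) (suc (suc k)) = atL xs (suc k)

-- row of the cell labeled i in column c (0 = no such cell; real rows are ≥ 1)
cell : Filling → ℕ → ℕ → ℕ
cell T i c = at (atL T i) c

allB : List ℕ → (ℕ → Bool) → Bool
allB xs p = foldr (λ x b → p x ∧ b) true xs

_≤ᵇ'_ : ℕ → ℕ → Bool
m ≤ᵇ' n = m <ᵇ suc n

module _ (n : ℕ) (as : List ℕ) (T : Filling) where
  private
    ai : ℕ → ℕ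
    ai i = at as i

  -- distinct labeled cells occupy distinct positions (a diagram is a set)
  distinctCells : Bool
  distinctCells = allB (range n) λ i → allB (range n) λ j →
    (i ≡ᵇ j) ∨ allB (range (ai i)) λ c → not (cell T i c ≡ᵇ cell T j c)

  -- (2) every label in row r is at least r
  cond2 : Bool
  cond2 = allB (range n) λ i → allB (range (ai i)) λ c → cell T i c ≤ᵇ' i

  -- (3) cells labeled i weakly descend from left to right
  cond3 : Bool
  cond3 = allB (range n) λ i → allB (range (ai i ∸ 1)) λ c →
    cell T i (suc c) ≤ᵇ' cell T i c

  -- (4) if i < j in the same column with i above j, then there is a cell
  -- labeled i in the next column strictly above the row of that j
  cond4 : Bool
  cond4 = allB (range n) λ i → allB (range n) λ j →
    not (i <ᵇ j) ∨ (allB (range (ai i ⊓ ai j)) λ c →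
      not (cell T j c <ᵇ cell T i c) ∨ (cell T j c <ᵇ cell T i (suc c)))

  isKKT : Bool
  isKKT = distinctCells ∧ cond2 ∧ cond3 ∧ cond4

countRow : Filling → ℕ → ℕ
countRow T r = sum (map (λ w → length (filter (λ x → T? (x ≡ᵇ r)) w)) T)

wt : (n : ℕ) → Filling → Vec ℕ n
wt n T = tabulate (λ r → countRow T (suc (toℕ r)))

eqVecᵇ : ∀ {n} → Vec ℕ n → Vec ℕ n → Bool
eqVecᵇ V.[]       V.[]       = true
eqVecᵇ (x V.∷ xs) (y V.∷ ys) = (x ≡ᵇ y) ∧ eqVecᵇ xs ys

KKT : ∀ {n} → Vec ℕ n → List Filling
KKT {n} a = filter (λ T → T? (isKKT n (toList a) T)) (fillings n (toList a))

-- The key polynomial κ_a in x_1..x_n, given by its coefficient function: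
-- the coefficient of x^e is #{T ∈ KKT(a) : wt(T) = e}.
keyCoeff : ∀ {n} → Vec ℕ n → Vec ℕ n → ℕ
keyCoeff {n} a e = length (filter (λ T → T? (eqVecᵇ (wt n T) e)) (KKT a))

-- exponent vector of x_{i_1}^{b_1} ... x_{i_k}^{b_k}
monomial : ∀ {n k} → Vec ℕ k → Vec (Fin n) k → Vec ℕ n
monomial V.[]       V.[]       = replicate _ 0
monomial (b V.∷ bs) (i V.∷ is) = monomial bs is [ i ]≔ b

StrictlyIncreasing : ∀ {n k} → Vec (Fin n) k → Set
StrictlyIncreasing {k = k} is = (p q : Fin k) → p F.< q → lookup is p F.< lookup is q

AllPositive : ∀ {k} → Vec ℕ k → Set
AllPositive {k} bs = (p : Fin k) → 0 < lookup bs p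

IsQuasisymmetric : (n : ℕ) → (Vec ℕ n → ℕ) → Set
IsQuasisymmetric n f =
  (k : ℕ) (b : Vec ℕ k) (i j : Vec (Fin n) k) →
  AllPositive b → StrictlyIncreasing i → StrictlyIncreasing j →
  f (monomial b i) ≡ f (monomial b j)

NoZeroParts : ∀ {n} → Vec ℕ n → Set
NoZeroParts {n} a = (p : Fin n) → 0 < lookup a p

WeaklyIncreasing : ∀ {n} → Vec ℕ n → Set
WeaklyIncreasing {n} a = (p q : Fin n) → p F.≤ q → lookup a p ≤ lookup a q

module Submission where

-- Write f = keyCoeff a for the coefficient function of κ_a.  f is quasisymmetric
-- iff it only depends on the compression of the exponent vector (its list of
-- nonzero entries).  Compression invariance follows from either of
--   * f is unchanged when a zero entry moves one step to the right, or
--   * f vanishes on every exponent vector with a zero entry.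
--
-- (⇐) If a is weakly increasing, exchanging rows r and r+1 maps the key Kohnert
-- tableaux with row r+1 empty bijectively onto those with row r empty, which
-- gives the first criterion.  If a has no zero part, the cell labeled i in
-- column 1 lies in row i, so no row is empty: the second criterion.
--
-- (⇒) Suppose a_p = 0 and a_{q+1} < a_q.  Dominance (the first q row counts of a
-- tableau's weight sum to at least a_1 + ⋯ + a_q) shows that the coefficient of
-- x^{s_q·a} is 0, while a tableau with constant rows has a weight with the same
-- compression as s_q·a; so f is not compression invariant.

open import Data.Nat using (ℕ; zero; suc; _+_; _∸_; _⊓_; _≡ᵇ_; _<ᵇ_; _≤_; _<_; _≟_; _≤?_; _<?_; z≤n; s≤s; s≤s⁻¹)
open import Data.Nat.Properties
open import Algebra.Properties.CommutativeSemigroup +-commutativeSemigroup using () renaming (interchange to +-interchange)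
open import Data.Nat.ListAction using (sum)
open import Data.Nat.ListAction.Properties using (sum-++)
open import Data.Bool using (Bool; true; false; _∧_; _∨_; not; if_then_else_; T)
open import Data.Bool.Properties using (∧-zeroʳ)
open import Data.List using (List; []; _∷_; map; concatMap; applyUpTo; length; filter; _++_; [_])
import Data.List as List
import Data.List.Properties as List
open import Data.List.Relation.Unary.All using (All; []; _∷_)
import Data.List.Relation.Unary.All as All
import Data.List.Relation.Unary.All.Properties as All
open import Data.List.Relation.Unary.Any using (here; there)
open import Data.List.Membership.Propositional using (_∈_)
open import Data.List.Membership.Propositional.Properties using (∈-map⁺; ∈-++⁺ˡ; ∈-++⁺ʳ)
open import Data.List.Relation.Binary.Permutation.Propositional as Perm using (_↭_; prep; swap; ↭-refl; ↭-trans; ↭-reflexive)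
import Data.List.Relation.Binary.Permutation.Propositional.Properties as ↭
open import Data.Vec using (Vec; []; _∷_; lookup; toList; fromList; tabulate)
import Data.Vec as Vec
open import Data.Vec.Properties using (lookup-map; length-toList)
open import Data.Fin using (Fin; zero; suc; toℕ; fromℕ<)
import Data.Fin as Fin
import Data.Fin.Properties as Fin
open import Data.Product using (Σ; _×_; _,_; proj₁; proj₂)
open import Data.Sum using (_⊎_; inj₁; inj₂)
open import Data.Empty using (⊥; ⊥-elim)
open import Relation.Nullary using (¬_; Dec; yes; no)
open import Relation.Nullary.Decidable using (T?; _→-dec_)
open import Relation.Binary.Definitions using (tri<; tri≈; tri>)
open import Relation.Binary.PropositionalEquality using (_≡_; _≢_; refl; sym; trans; cong; cong₂; subst; subst₂; module ≡-Reasoning)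
open import Function.Bundles using (_⇔_; mk⇔; Equivalence)
open import Defs

true≢false : true ≢ false
true≢false ()

≡ᵇ-sound : ∀ m n → (m ≡ᵇ n) ≡ true → m ≡ n
≡ᵇ-sound m n e = ≡ᵇ⇒≡ m n (subst T (sym e) _)

≡ᵇ-refl : ∀ m → (m ≡ᵇ m) ≡ true
≡ᵇ-refl zero    = refl
≡ᵇ-refl (suc m) = ≡ᵇ-refl m

≡ᵇ-false : ∀ m n → m ≢ n → (m ≡ᵇ n) ≡ false
≡ᵇ-false m n m≢n with m ≡ᵇ n in eq
... | false = refl
... | true  = ⊥-elim (m≢n (≡ᵇ-sound m n eq))

≡ᵇ-false-sound : ∀ m n → (m ≡ᵇ n) ≡ false → m ≢ n
≡ᵇ-false-sound m .m e refl = true≢false (trans (sym (≡ᵇ-refl m)) e)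

<ᵇ-sound : ∀ m n → (m <ᵇ n) ≡ true → m < n
<ᵇ-sound m n e = <ᵇ⇒< m n (subst T (sym e) _)

<ᵇ-complete : ∀ {m n} → m < n → (m <ᵇ n) ≡ true
<ᵇ-complete {m} {n} m<n with m <ᵇ n | <⇒<ᵇ m<n
... | true | _ = refl

<ᵇ-false : ∀ {m n} → n ≤ m → (m <ᵇ n) ≡ false
<ᵇ-false {m} {n} n≤m with m <ᵇ n in eq
... | false = refl
... | true  = ⊥-elim (<⇒≱ (<ᵇ-sound m n eq) n≤m)

<ᵇ-false-sound : ∀ m n → (m <ᵇ n) ≡ false → n ≤ m
<ᵇ-false-sound m n e = ≮⇒≥ (λ m<n → true≢false (trans (sym (<ᵇ-complete m<n)) e))

≤ᵇ-sound : ∀ m n → (m ≤ᵇ' n) ≡ true → m ≤ n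
≤ᵇ-sound m n e = s≤s⁻¹ (<ᵇ-sound m (suc n) e)

≤ᵇ-complete : ∀ {m n} → m ≤ n → (m ≤ᵇ' n) ≡ true
≤ᵇ-complete m≤n = <ᵇ-complete (s≤s m≤n)

≤ᵇ-false-sound : ∀ m n → (m ≤ᵇ' n) ≡ false → n < m
≤ᵇ-false-sound m n e = <ᵇ-false-sound m (suc n) e

∧-intro : ∀ {a b} → a ≡ true → b ≡ true → (a ∧ b) ≡ true
∧-intro refl refl = refl

∧-left : ∀ a {b} → (a ∧ b) ≡ true → a ≡ true
∧-left true  _ = refl

∧-right : ∀ a {b} → (a ∧ b) ≡ true → b ≡ true
∧-right true e = e

∨-elim : ∀ a {b} → (a ∨ b) ≡ true → (a ≡ true) ⊎ (b ≡ true)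
∨-elim true  _ = inj₁ refl
∨-elim false e = inj₂ e

not-sound : ∀ a → not a ≡ true → a ≡ false
not-sound false _ = refl

bool-ext : ∀ {a b : Bool} → (a ≡ true → b ≡ true) → (b ≡ true → a ≡ true) → a ≡ b
bool-ext {true}  {true}  f g = refl
bool-ext {true}  {false} f g = sym (f refl)
bool-ext {false} {true}  f g = g refl
bool-ext {false} {false} f g = refl

interval : ℕ → ℕ → List ℕ
interval lo zero    = []
interval lo (suc k) = lo ∷ interval (suc lo) k

lo<lo+suc : ∀ lo k → lo < lo + suc k
lo<lo+suc lo k = m<m+n lo (s≤s z≤n)

<-shift : ∀ {x} lo k → x < suc lo + k → x < lo + suc k
<-shift {x} lo k = subst (x <_) (sym (+-suc lo k))

empty-interval : ∀ {lo x} → lo ≤ x → x < lo + 0 → ⊥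
empty-interval {lo} lo≤x x<lo = <⇒≱ x<lo (subst (_≤ _) (sym (+-identityʳ lo)) lo≤x)

range≡interval : ∀ k → range k ≡ interval 1 k
range≡interval k = go (λ i → i) 0 k (λ i → refl)
  where
  go : ∀ (f : ℕ → ℕ) lo k → (∀ i → f i ≡ lo + i) → map suc (applyUpTo f k) ≡ interval (suc lo) k
  go f lo zero    h = refl
  go f lo (suc k) h = cong₂ _∷_ (cong suc (trans (h 0) (+-identityʳ lo)))
    (go (λ i → f (suc i)) (suc lo) k (λ i → trans (h (suc i)) (+-suc lo i)))

interval-suc : ∀ lo k → interval (suc lo) k ≡ map suc (interval lo k)
interval-suc lo zero    = refl
interval-suc lo (suc k) = cong (suc lo ∷_) (interval-suc (suc lo) k)

interval-++ : ∀ lo k m → interval lo (k + m) ≡ interval lo k ++ interval (lo + k) m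
interval-++ lo zero    m = cong (λ z → interval z m) (sym (+-identityʳ lo))
interval-++ lo (suc k) m = cong (lo ∷_) (trans (interval-++ (suc lo) k m)
  (cong (λ z → interval (suc lo) k ++ interval z m) (sym (+-suc lo k))))

length-interval : ∀ lo k → length (interval lo k) ≡ k
length-interval lo zero    = refl
length-interval lo (suc k) = cong suc (length-interval (suc lo) k)

all-interval : ∀ lo k → All (λ x → lo ≤ x × x < lo + k) (interval lo k)
all-interval lo zero    = []
all-interval lo (suc k) = (≤-refl , lo<lo+suc lo k)
  ∷ All.map (λ { (l , u) → <⇒≤ l , <-shift lo k u }) (all-interval (suc lo) k)

∈-interval : ∀ lo k x → lo ≤ x → x < lo + k → x ∈ interval lo k
∈-interval lo zero    x l u = ⊥-elim (empty-interval l u)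
∈-interval lo (suc k) x l u with m≤n⇒m<n∨m≡n l
... | inj₂ refl = here refl
... | inj₁ lt   = there (∈-interval (suc lo) k x lt (subst (x <_) (+-suc lo k) u))

allB-interval-intro : ∀ lo k (p : ℕ → Bool) →
  (∀ x → lo ≤ x → x < lo + k → p x ≡ true) → allB (interval lo k) p ≡ true
allB-interval-intro lo zero    p h = refl
allB-interval-intro lo (suc k) p h = ∧-intro (h lo ≤-refl (lo<lo+suc lo k))
  (allB-interval-intro (suc lo) k p (λ x l u → h x (<⇒≤ l) (<-shift lo k u)))

allB-interval-elim : ∀ lo k (p : ℕ → Bool) → allB (interval lo k) p ≡ true →
  ∀ x → lo ≤ x → x < lo + k → p x ≡ true
allB-interval-elim lo zero    p e x l u = ⊥-elim (empty-interval l u)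
allB-interval-elim lo (suc k) p e x l u with m≤n⇒m<n∨m≡n l
... | inj₂ refl = ∧-left (p lo) e
... | inj₁ lt   = allB-interval-elim (suc lo) k p (∧-right (p lo) e) x lt (subst (x <_) (+-suc lo k) u)

allB-range-intro : ∀ k (p : ℕ → Bool) → (∀ x → 1 ≤ x → x ≤ k → p x ≡ true) → allB (range k) p ≡ true
allB-range-intro k p h rewrite range≡interval k = allB-interval-intro 1 k p (λ x l u → h x l (s≤s⁻¹ u))

allB-range-elim : ∀ k (p : ℕ → Bool) → allB (range k) p ≡ true → ∀ x → 1 ≤ x → x ≤ k → p x ≡ true
allB-range-elim k p e x l u rewrite range≡interval k = allB-interval-elim 1 k p e x l (s≤s u)

allB-cong : ∀ xs (p q : ℕ → Bool) → (∀ x → p x ≡ q x) → allB xs p ≡ allB xs q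
allB-cong []       p q h = refl
allB-cong (x ∷ xs) p q h = cong₂ _∧_ (h x) (allB-cong xs p q h)

nth : ∀ {A : Set} → A → List A → ℕ → A
nth d []       _             = d
nth d (x ∷ xs) zero          = d
nth d (x ∷ xs) (suc zero)    = x
nth d (x ∷ xs) (suc (suc k)) = nth d xs (suc k)

at≡nth : ∀ xs i → at xs i ≡ nth 0 xs i
at≡nth []       i             = refl
at≡nth (x ∷ xs) zero          = refl
at≡nth (x ∷ xs) (suc zero)    = refl
at≡nth (x ∷ xs) (suc (suc i)) = at≡nth xs (suc i)

atL≡nth : ∀ xs i → atL xs i ≡ nth [] xs i
atL≡nth []       i             = refl
atL≡nth (x ∷ xs) zero          = refl
atL≡nth (x ∷ xs) (suc zero)    = refl
atL≡nth (x ∷ xs) (suc (suc i)) = atL≡nth xs (suc i)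

nth-map : ∀ {A B : Set} (f : A → B) d xs i → nth (f d) (map f xs) i ≡ f (nth d xs i)
nth-map f d []       i             = refl
nth-map f d (x ∷ xs) zero          = refl
nth-map f d (x ∷ xs) (suc zero)    = refl
nth-map f d (x ∷ xs) (suc (suc i)) = nth-map f d xs (suc i)

nth-beyond : ∀ {A : Set} (d : A) xs i → length xs < i → nth d xs i ≡ d
nth-beyond d []       i             _         = refl
nth-beyond d (x ∷ xs) (suc (suc i)) (s≤s lt) = nth-beyond d xs (suc i) lt

nth-map-interval : ∀ {A : Set} (d : A) (h : ℕ → A) k i → 1 ≤ i → i ≤ k → nth d (map h (interval 1 k)) i ≡ h i
nth-map-interval d h (suc k) (suc zero)    l u       = refl
nth-map-interval d h (suc k) (suc (suc i)) l (s≤s u) =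
  trans (cong (λ z → nth d (map h z) (suc i)) (interval-suc 1 k))
  (trans (cong (λ z → nth d z (suc i)) (sym (List.map-∘ (interval 1 k))))
   (nth-map-interval d (λ z → h (suc z)) k (suc i) (s≤s z≤n) u))

list≡tabulated : ∀ {A : Set} (d : A) (xs : List A) → xs ≡ map (nth d xs) (interval 1 (length xs))
list≡tabulated d []       = refl
list≡tabulated d (x ∷ xs) = cong (x ∷_) (begin
    xs                                                       ≡⟨ list≡tabulated d xs ⟩
    map (nth d xs) (interval 1 (length xs))                  ≡⟨ List.map-cong-local (All.map shift (all-interval 1 (length xs))) ⟩
    map (λ i → nth d (x ∷ xs) (suc i)) (interval 1 (length xs)) ≡⟨ List.map-∘ (interval 1 (length xs)) ⟩
    map (nth d (x ∷ xs)) (map suc (interval 1 (length xs)))  ≡⟨ cong (map (nth d (x ∷ xs))) (sym (interval-suc 1 (length xs))) ⟩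
    map (nth d (x ∷ xs)) (interval 2 (length xs))            ∎)
  where
  open ≡-Reasoning
  shift : ∀ {i} → 1 ≤ i × i < 1 + length xs → nth d xs i ≡ nth d (x ∷ xs) (suc i)
  shift {suc i} _ = refl

cnt : ∀ {A : Set} → (A → Bool) → List A → ℕ
cnt f []       = 0
cnt f (x ∷ xs) = if f x then suc (cnt f xs) else cnt f xs

length-filter : ∀ {A : Set} (f : A → Bool) xs → length (filter (λ x → T? (f x)) xs) ≡ cnt f xs
length-filter f [] = refl
length-filter f (x ∷ xs) with f x
... | true  = cong suc (length-filter f xs)
... | false = length-filter f xs

length-filter-filter : ∀ {A : Set} (f g : A → Bool) xs →
  length (filter (λ x → T? (g x)) (filter (λ x → T? (f x)) xs)) ≡ cnt (λ x → f x ∧ g x) xs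
length-filter-filter f g [] = refl
length-filter-filter f g (x ∷ xs) with f x
... | false = length-filter-filter f g xs
... | true with g x
...   | true  = cong suc (length-filter-filter f g xs)
...   | false = length-filter-filter f g xs

cnt-map : ∀ {A B : Set} (f : B → Bool) (g : A → B) xs → cnt f (map g xs) ≡ cnt (λ x → f (g x)) xs
cnt-map f g [] = refl
cnt-map f g (x ∷ xs) with f (g x)
... | true  = cong suc (cnt-map f g xs)
... | false = cnt-map f g xs

cnt-cong-All : ∀ {A : Set} {P : A → Set} (f g : A → Bool) → (∀ x → P x → f x ≡ g x) →
  ∀ xs → All P xs → cnt f xs ≡ cnt g xs
cnt-cong-All f g h []       []         = refl
cnt-cong-All f g h (x ∷ xs) (px ∷ pxs) rewrite h x px with g x
... | true  = cong suc (cnt-cong-All f g h xs pxs)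
... | false = cnt-cong-All f g h xs pxs

cnt-cong : ∀ {A : Set} (f g : A → Bool) → (∀ x → f x ≡ g x) → ∀ xs → cnt f xs ≡ cnt g xs
cnt-cong f g h [] = refl
cnt-cong f g h (x ∷ xs) rewrite h x with g x
... | true  = cong suc (cnt-cong f g h xs)
... | false = cnt-cong f g h xs

cnt-↭ : ∀ {A : Set} (f : A → Bool) {xs ys} → xs ↭ ys → cnt f xs ≡ cnt f ys
cnt-↭ f {xs} {ys} p = begin
  cnt f xs                               ≡⟨ sym (length-filter f xs) ⟩
  length (filter (λ x → T? (f x)) xs)    ≡⟨ ↭.↭-length (↭.filter-↭ (λ x → T? (f x)) p) ⟩
  length (filter (λ x → T? (f x)) ys)    ≡⟨ length-filter f ys ⟩
  cnt f ys                               ∎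
  where open ≡-Reasoning

cnt-false : ∀ {A : Set} (xs : List A) → cnt (λ _ → false) xs ≡ 0
cnt-false []       = refl
cnt-false (x ∷ xs) = cnt-false xs

cnt-pos : ∀ {A : Set} (f : A → Bool) {x} xs → x ∈ xs → f x ≡ true → 1 ≤ cnt f xs
cnt-pos f (y ∷ xs) (here refl) e rewrite e = s≤s z≤n
cnt-pos f (y ∷ xs) (there p)   e with f y
... | true  = s≤s z≤n
... | false = cnt-pos f xs p e

cnt-all : ∀ {A : Set} (f : A → Bool) w → All (λ x → f x ≡ true) w → cnt f w ≡ length w
cnt-all f []      []       = refl
cnt-all f (x ∷ w) (p ∷ ps) rewrite p = cong suc (cnt-all f w ps)

Σ[_]_ : ∀ {A : Set} → List A → (A → ℕ) → ℕ
Σ[ S ] g = sum (map g S)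

ind : Bool → ℕ
ind true  = 1
ind false = 0

cnt-cons : ∀ {A : Set} (f : A → Bool) x w → cnt f (x ∷ w) ≡ ind (f x) + cnt f w
cnt-cons f x w with f x
... | true  = refl
... | false = refl

Σ-+ : ∀ {A : Set} (f g : A → ℕ) L → Σ[ L ] (λ x → f x + g x) ≡ Σ[ L ] f + Σ[ L ] g
Σ-+ f g []      = refl
Σ-+ f g (x ∷ L) = trans (cong (f x + g x +_) (Σ-+ f g L)) (+-interchange (f x) (g x) _ _)

Σ-zero : ∀ {A : Set} (g : A → ℕ) L → All (λ x → g x ≡ 0) L → Σ[ L ] g ≡ 0
Σ-zero g []      []       = refl
Σ-zero g (x ∷ L) (p ∷ ps) = cong₂ _+_ p (Σ-zero g L ps)

Σ-cong-All : ∀ {A : Set} {P : A → Set} (f g : A → ℕ) L → All P L → (∀ x → P x → f x ≡ g x) → Σ[ L ] f ≡ Σ[ L ] g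
Σ-cong-All f g []      []       h = refl
Σ-cong-All f g (x ∷ L) (p ∷ ps) h = cong₂ _+_ (h x p) (Σ-cong-All f g L ps h)

Σ-cong : ∀ {A : Set} (f g : A → ℕ) L → (∀ x → f x ≡ g x) → Σ[ L ] f ≡ Σ[ L ] g
Σ-cong f g L h = cong sum (List.map-cong h L)

Σ-map : ∀ {A B : Set} (f : B → ℕ) (g : A → B) L → Σ[ map g L ] f ≡ Σ[ L ] (λ x → f (g x))
Σ-map f g L = cong sum (sym (List.map-∘ L))

Σ-swap : ∀ {A : Set} (g : ℕ → A → ℕ) S L → Σ[ S ] (λ s → Σ[ L ] (g s)) ≡ Σ[ L ] (λ w → Σ[ S ] (λ s → g s w))
Σ-swap g []      L = sym (Σ-zero (λ _ → 0) L (All.universal (λ _ → refl) L))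
Σ-swap g (s ∷ S) L = trans (cong (Σ[ L ] (g s) +_) (Σ-swap g S L)) (sym (Σ-+ (g s) (λ w → Σ[ S ] (λ s → g s w)) L))

Σ-++ : ∀ {A : Set} (g : A → ℕ) S S' → Σ[ S ++ S' ] g ≡ Σ[ S ] g + Σ[ S' ] g
Σ-++ g S S' = trans (cong sum (List.map-++ g S S')) (sum-++ (map g S) (map g S'))

Σ-single : ∀ lo k (g : ℕ → ℕ) t → lo ≤ t → t < lo + k →
  (∀ i → lo ≤ i → i < lo + k → i ≢ t → g i ≡ 0) → Σ[ interval lo k ] g ≡ g t
Σ-single lo zero    g t l u h = ⊥-elim (empty-interval l u)
Σ-single lo (suc k) g t l u h with m≤n⇒m<n∨m≡n l
... | inj₂ refl = trans (cong (g lo +_) rest-vanishes) (+-identityʳ (g lo))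
  where
  rest-vanishes : Σ[ interval (suc lo) k ] g ≡ 0
  rest-vanishes = Σ-zero g (interval (suc lo) k) (All.map (λ { (l' , u') →
    h _ (<⇒≤ l') (<-shift lo k u') (>⇒≢ l') }) (all-interval (suc lo) k))
... | inj₁ lo<t = cong₂ _+_ (h lo ≤-refl (lo<lo+suc lo k) (<⇒≢ lo<t))
  (Σ-single (suc lo) k g t lo<t (subst (t <_) (+-suc lo k) u) (λ i l' u' → h i (<⇒≤ l') (<-shift lo k u')))

compress : ∀ {n} → Vec ℕ n → List ℕ
compress []          = []
compress (zero ∷ v)  = compress v
compress (suc x ∷ v) = suc x ∷ compress v

CompressionInvariant : ∀ {A : Set} (n : ℕ) → (Vec ℕ n → A) → Set
CompressionInvariant n f = ∀ e e' → compress e ≡ compress e' → f e ≡ f e'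

monomial-shift : ∀ {n k} (b : Vec ℕ k) (t : Vec (Fin n) k) → monomial b (Vec.map suc t) ≡ 0 ∷ monomial b t
monomial-shift []       []       = refl
monomial-shift (b ∷ bs) (t ∷ ts) rewrite monomial-shift bs ts = refl

monomial-cons : ∀ {n k} x (b : Vec ℕ k) (t : Vec (Fin n) k) → monomial (x ∷ b) (zero ∷ Vec.map suc t) ≡ x ∷ monomial b t
monomial-cons x b t rewrite monomial-shift b t = refl

compress-zeros : ∀ k → compress (Vec.replicate k 0) ≡ []
compress-zeros zero    = refl
compress-zeros (suc k) = compress-zeros k

increasing-shift : ∀ {n k} (t : Vec (Fin n) k) → StrictlyIncreasing t → StrictlyIncreasing (Vec.map suc t)
increasing-shift t si p q p<q =
  subst₂ (λ x y → toℕ x < toℕ y) (sym (lookup-map p suc t)) (sym (lookup-map q suc t)) (s≤s (si p q p<q))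

increasing-unshift : ∀ {n k} (t : Vec (Fin n) k) → StrictlyIncreasing (Vec.map suc t) → StrictlyIncreasing t
increasing-unshift t si p q p<q =
  s≤s⁻¹ (subst₂ (λ x y → toℕ x < toℕ y) (lookup-map p suc t) (lookup-map q suc t) (si p q p<q))

increasing-cons : ∀ {n k} (t : Vec (Fin n) k) → StrictlyIncreasing t → StrictlyIncreasing (zero ∷ Vec.map suc t)
increasing-cons t si zero    (suc q) _         = subst (λ y → 0 < toℕ y) (sym (lookup-map q suc t)) (s≤s z≤n)
increasing-cons t si (suc p) (suc q) (s≤s p<q) = increasing-shift t si p q p<q

increasing-tail : ∀ {n k} h (t : Vec (Fin n) k) → StrictlyIncreasing (h ∷ t) → StrictlyIncreasing t
increasing-tail h t si p q p<q = si (suc p) (suc q) (s≤s p<q)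

unshift : ∀ {n k} (t : Vec (Fin (suc n)) k) → (∀ p → 0 < toℕ (lookup t p)) →
  Σ (Vec (Fin n) k) λ t' → t ≡ Vec.map suc t'
unshift []          h = [] , refl
unshift (zero ∷ t)  h with () ← h zero
unshift (suc x ∷ t) h with unshift t (λ p → h (suc p))
... | t' , refl = (x ∷ t') , refl

compress-monomial : ∀ {n k} (b : Vec ℕ k) (i : Vec (Fin n) k) → AllPositive b → StrictlyIncreasing i →
  compress (monomial b i) ≡ toList b
compress-monomial {n} [] [] pos si = compress-zeros n
compress-monomial {suc n} (b ∷ bs) (h ∷ is) pos si
  with unshift is (λ p → <-≤-trans (s≤s z≤n) (si zero (suc p) (s≤s z≤n)))
compress-monomial {suc n} (b ∷ bs) (zero ∷ is) pos si | t , refl with b | pos zero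
... | suc b' | _ rewrite monomial-cons (suc b') bs t = cong (suc b' ∷_)
  (compress-monomial bs t (λ p → pos (suc p)) (increasing-unshift t (increasing-tail zero (Vec.map suc t) si)))
compress-monomial {suc n} (b ∷ bs) (suc h ∷ is) pos si | t , refl =
  trans (cong compress (monomial-shift (b ∷ bs) (h ∷ t)))
        (compress-monomial (b ∷ bs) (h ∷ t) pos (increasing-unshift (h ∷ t) si))

compress-positive : ∀ {n} (e : Vec ℕ n) → AllPositive (fromList (compress e))
compress-positive (zero ∷ e)  p       = compress-positive e p
compress-positive (suc x ∷ e) zero    = s≤s z≤n
compress-positive (suc x ∷ e) (suc p) = compress-positive e p

monomial-of-compress : ∀ {n} (e : Vec ℕ n) → Σ (Vec (Fin n) (length (compress e))) λ i →
  StrictlyIncreasing i × monomial (fromList (compress e)) i ≡ e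
monomial-of-compress [] = [] , (λ ()) , refl
monomial-of-compress (zero ∷ e) with monomial-of-compress e
... | i , si , eq = Vec.map suc i , increasing-shift i si ,
                    trans (monomial-shift (fromList (compress e)) i) (cong (0 ∷_) eq)
monomial-of-compress (suc x ∷ e) with monomial-of-compress e
... | i , si , eq = zero ∷ Vec.map suc i , increasing-cons i si ,
                    trans (monomial-cons (suc x) (fromList (compress e)) i) (cong (suc x ∷_) eq)

monomial-with-compression : ∀ {n} (e : Vec ℕ n) c → compress e ≡ c → Σ (Vec (Fin n) (length c)) λ i →
  AllPositive (fromList c) × StrictlyIncreasing i × monomial (fromList c) i ≡ e
monomial-with-compression e _ refl with monomial-of-compress e
... | i , si , eq = i , compress-positive e , si , eq

quasisymmetric⇒compression-invariant : ∀ n f → IsQuasisymmetric n f → CompressionInvariant n f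
quasisymmetric⇒compression-invariant n f qsym e e' c≡c'
  with monomial-with-compression e (compress e) refl | monomial-with-compression e' (compress e) (sym c≡c')
... | i , pos , si , mi | j , _ , sj , mj =
  trans (sym (cong f mi)) (trans (qsym _ (fromList (compress e)) i j pos si sj) (cong f mj))

compression-invariant⇒quasisymmetric : ∀ n f → CompressionInvariant n f → IsQuasisymmetric n f
compression-invariant⇒quasisymmetric n f ci k b i j pos si sj =
  ci _ _ (trans (compress-monomial b i pos si) (sym (compress-monomial b j pos sj)))

data ZeroShift : ∀ {n} → Vec ℕ n → Vec ℕ n → Set where
  here  : ∀ {n} y (t : Vec ℕ n) → ZeroShift (0 ∷ y ∷ t) (y ∷ 0 ∷ t)
  there : ∀ {n} x {u v : Vec ℕ n} → ZeroShift u v → ZeroShift (x ∷ u) (x ∷ v)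

ZeroShiftInvariant : ∀ {A : Set} (n : ℕ) → (Vec ℕ n → A) → Set
ZeroShiftInvariant n f = ∀ u v → ZeroShift u v → f u ≡ f v

zero-shift-invariant-tail : ∀ {A : Set} {n} x (f : Vec ℕ (suc n) → A) →
  ZeroShiftInvariant (suc n) f → ZeroShiftInvariant n (λ v → f (x ∷ v))
zero-shift-invariant-tail x f inv u v s = inv _ _ (there x s)

pull-first-part : ∀ {A : Set} {m} (g : Vec ℕ (suc m) → A) → ZeroShiftInvariant (suc m) g →
  ∀ (es : Vec ℕ (suc m)) y c → compress es ≡ suc y ∷ c →
  Σ (Vec ℕ m) λ t → compress t ≡ c × g es ≡ g (suc y ∷ t)
pull-first-part g inv (suc x ∷ es) y c eq with refl , eq' ← List.∷-injective eq = es , eq' , refl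
pull-first-part {m = zero}  g inv (zero ∷ []) y c ()
pull-first-part {m = suc m} g inv (zero ∷ zs) y c eq
  with pull-first-part (λ v → g (0 ∷ v)) (zero-shift-invariant-tail 0 g inv) zs y c eq
... | t , ct , g≡ = (0 ∷ t) , ct , trans g≡ (inv _ _ (here (suc y) t))

zero-shift⇒compression-invariant : ∀ {A : Set} n (f : Vec ℕ n → A) →
  ZeroShiftInvariant n f → CompressionInvariant n f
leading-part : ∀ {A : Set} n (f : Vec ℕ (suc n) → A) → ZeroShiftInvariant (suc n) f →
  ∀ x es e' → compress e' ≡ suc x ∷ compress es → f (suc x ∷ es) ≡ f e'

zero-shift⇒compression-invariant zero    f inv [] [] eq = refl
zero-shift⇒compression-invariant (suc n) f inv (zero ∷ es) (zero ∷ es') eq =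
  zero-shift⇒compression-invariant n (λ v → f (0 ∷ v)) (zero-shift-invariant-tail 0 f inv) es es' eq
zero-shift⇒compression-invariant (suc n) f inv (suc x ∷ es) e' eq = leading-part n f inv x es e' (sym eq)
zero-shift⇒compression-invariant (suc n) f inv (zero ∷ es) (suc y ∷ es') eq = sym (leading-part n f inv y es' (zero ∷ es) eq)

leading-part n f inv x es e' eq with pull-first-part f inv e' x (compress es) eq
... | t , ct , f≡ = trans (zero-shift⇒compression-invariant n (λ v → f (suc x ∷ v))
                             (zero-shift-invariant-tail (suc x) f inv) es t (sym ct)) (sym f≡)

HasZero : ∀ {n} → Vec ℕ n → Set
HasZero {n} v = Σ (Fin n) λ p → lookup v p ≡ 0

compress-length : ∀ {n} (v : Vec ℕ n) → length (compress v) ≤ n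
compress-length []          = z≤n
compress-length (zero ∷ v)  = m≤n⇒m≤1+n (compress-length v)
compress-length (suc x ∷ v) = s≤s (compress-length v)

short⇒has-zero : ∀ {n} (v : Vec ℕ n) → length (compress v) < n → HasZero v
short⇒has-zero (zero ∷ v)  _       = zero , refl
short⇒has-zero (suc x ∷ v) (s≤s l) with p , vp ← short⇒has-zero v l = suc p , vp

has-zero-cons : ∀ {n} x (v : Vec ℕ n) → HasZero v → HasZero (x ∷ v)
has-zero-cons x v (p , vp) = suc p , vp

same-compression : ∀ {n} (e e' : Vec ℕ n) → compress e ≡ compress e' → e ≡ e' ⊎ (HasZero e × HasZero e')
same-compression []          []            eq = inj₁ refl
same-compression (zero ∷ e)  (zero ∷ e')   eq = inj₂ ((zero , refl) , (zero , refl))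
same-compression (suc x ∷ e) (suc y ∷ e')  eq with refl , eq' ← List.∷-injective eq with same-compression e e' eq'
... | inj₁ refl       = inj₁ refl
... | inj₂ (z , z')   = inj₂ (has-zero-cons _ e z , has-zero-cons _ e' z')
same-compression (zero ∷ e)  (suc y ∷ e')  eq =
  inj₂ ((zero , refl) , has-zero-cons _ e' (short⇒has-zero e' (subst (λ l → length l ≤ _) eq (compress-length e))))
same-compression (suc x ∷ e) (zero ∷ e')   eq =
  inj₂ (has-zero-cons _ e (short⇒has-zero e (subst (λ l → length l ≤ _) (sym eq) (compress-length e'))) , (zero , refl))

vanishing-on-zeros⇒compression-invariant : ∀ n (f : Vec ℕ n → ℕ) →
  (∀ e → HasZero e → f e ≡ 0) → CompressionInvariant n f
vanishing-on-zeros⇒compression-invariant n f vanish e e' eq with same-compression e e' eq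
... | inj₁ refl     = refl
... | inj₂ (z , z') = trans (vanish e z) (sym (vanish e' z'))

ValidWord : ℕ → List ℕ → Set
ValidWord n w = All (λ x → 1 ≤ x × x ≤ n) w

data Shape (n : ℕ) : List ℕ → Filling → Set where
  []ₛ   : Shape n [] []
  _∷ₛ_ : ∀ {a as w T} → length w ≡ a × ValidWord n w → Shape n as T → Shape n (a ∷ as) (w ∷ T)

all-concatMap : ∀ {A B : Set} {P : A → Set} {Q : B → Set} (f : A → List B) xs →
  All P xs → (∀ x → P x → All Q (f x)) → All Q (concatMap f xs)
all-concatMap f []       []       h = []
all-concatMap f (x ∷ xs) (p ∷ ps) h = All.++⁺ (h x p) (all-concatMap f xs ps h)

all-range : ∀ n → All (λ x → 1 ≤ x × x ≤ n) (range n)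
all-range n rewrite range≡interval n = All.map (λ { (l , u) → l , s≤s⁻¹ u }) (all-interval 1 n)

words-valid : ∀ n k → All (λ w → length w ≡ k × ValidWord n w) (words n k)
words-valid n zero    = (refl , []) ∷ []
words-valid n (suc k) = all-concatMap _ (range n) (all-range n)
  (λ x px → All.map⁺ (All.map (λ { (l , v) → cong suc l , (px ∷ v) }) (words-valid n k)))

fillings-shape : ∀ n as → All (Shape n as) (fillings n as)
fillings-shape n []       = []ₛ ∷ []
fillings-shape n (a ∷ as) = all-concatMap _ (words n a) (words-valid n a)
  (λ w pw → All.map⁺ (All.map (pw ∷ₛ_) (fillings-shape n as)))

∈-concatMap : ∀ {A B : Set} (f : A → List B) {x y} xs → y ∈ f x → x ∈ xs → y ∈ concatMap f xs
∈-concatMap f (x ∷ xs) p (here refl) = ∈-++⁺ˡ p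
∈-concatMap f (z ∷ xs) p (there q)   = ∈-++⁺ʳ (f z) (∈-concatMap f xs p q)

∈-range : ∀ n x → 1 ≤ x → x ≤ n → x ∈ range n
∈-range n x l u rewrite range≡interval n = ∈-interval 1 n x l (s≤s u)

∈-words : ∀ n k w → length w ≡ k → ValidWord n w → w ∈ words n k
∈-words n zero    []      refl []              = here refl
∈-words n (suc k) (x ∷ w) refl ((l , u) ∷ v) =
  ∈-concatMap (λ r → map (r ∷_) (words n k)) (range n) (∈-map⁺ (x ∷_) (∈-words n k w refl v)) (∈-range n x l u)

∈-fillings : ∀ n as T → Shape n as T → T ∈ fillings n as
∈-fillings n []       []      []ₛ                 = here refl
∈-fillings n (a ∷ as) (w ∷ T) ((l , v) ∷ₛ s) =
  ∈-concatMap (λ w → map (w ∷_) (fillings n as)) (words n a) (∈-map⁺ (w ∷_) (∈-fillings n as T s)) (∈-words n a w l v)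

shape-length : ∀ {n as T} → Shape n as T → length T ≡ length as
shape-length []ₛ      = refl
shape-length (_ ∷ₛ s) = cong suc (shape-length s)

shape-valid : ∀ {n as T} → Shape n as T → All (ValidWord n) T
shape-valid []ₛ            = []
shape-valid ((_ , v) ∷ₛ s) = v ∷ shape-valid s

shape-row-length : ∀ {n as T} → Shape n as T → ∀ i → length (atL T i) ≡ at as i
shape-row-length []ₛ            i             = refl
shape-row-length (_ ∷ₛ s)       zero          = refl
shape-row-length ((l , _) ∷ₛ s) (suc zero)    = l
shape-row-length (_ ∷ₛ s)       (suc (suc i)) = shape-row-length s (suc i)

shape-intro : ∀ n as T → length T ≡ length as →
  (∀ i → 1 ≤ i → i ≤ length as → length (atL T i) ≡ at as i × ValidWord n (atL T i)) → Shape n as T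
shape-intro n []       []      e h = []ₛ
shape-intro n (a ∷ as) (w ∷ T) e h = h 1 ≤-refl (s≤s z≤n)
  ∷ₛ shape-intro n as T (suc-injective e) (λ { (suc i) l u → h (suc (suc i)) (s≤s z≤n) (s≤s u) })

nth-All : ∀ {A : Set} {P : A → Set} d xs → P d → All P xs → ∀ i → P (nth d xs i)
nth-All d []       pd []       i             = pd
nth-All d (x ∷ xs) pd (p ∷ ps) zero          = pd
nth-All d (x ∷ xs) pd (p ∷ ps) (suc zero)    = p
nth-All d (x ∷ xs) pd (p ∷ ps) (suc (suc i)) = nth-All d xs pd ps (suc i)

nth-All-inside : ∀ {A : Set} {P : A → Set} d xs → All P xs → ∀ i → 1 ≤ i → i ≤ length xs → P (nth d xs i)
nth-All-inside d (x ∷ xs) (p ∷ ps) (suc zero)    l u       = p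
nth-All-inside d (x ∷ xs) (p ∷ ps) (suc (suc i)) l (s≤s u) = nth-All-inside d xs ps (suc i) (s≤s z≤n) u

all-cell : ∀ {P : ℕ → Set} T → P 0 → All (All P) T → ∀ i c → P (cell T i c)
all-cell {P} T p0 h i c rewrite at≡nth (atL T i) c | atL≡nth T i =
  nth-All 0 (nth [] T i) p0 (nth-All {P = All P} [] T [] h i) c

cell-range : ∀ {n as T} → Shape n as T → ∀ i c → 1 ≤ c → c ≤ at as i → 1 ≤ cell T i c × cell T i c ≤ n
cell-range {n} {T = T} s i c l u rewrite at≡nth (atL T i) c =
  nth-All-inside 0 (atL T i) row-valid c l (subst (c ≤_) (sym (shape-row-length s i)) u)
  where
  row-valid : ValidWord n (atL T i)
  row-valid = subst (ValidWord n) (sym (atL≡nth T i)) (nth-All [] T [] (shape-valid s) i)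

cell-beyond : ∀ {n as T} → Shape n as T → ∀ i c → at as i < c → cell T i c ≡ 0
cell-beyond {T = T} s i c u =
  trans (at≡nth (atL T i) c) (nth-beyond 0 (atL T i) c (subst (_< c) (sym (shape-row-length s i)) u))

rowcount : ℕ → List ℕ → ℕ
rowcount s w = length (filter (λ x → T? (x ≡ᵇ s)) w)

rowcount-cons : ∀ s x w → rowcount s (x ∷ w) ≡ ind (x ≡ᵇ s) + rowcount s w
rowcount-cons s x w with x ≡ᵇ s
... | true  = refl
... | false = refl

empty-row : ∀ T s → countRow T s ≡ 0 → All (All (λ x → x ≢ s)) T
empty-row []      s e = []
empty-row (w ∷ T) s e = word-avoids w (m+n≡0⇒m≡0 (rowcount s w) e) ∷ empty-row T s (m+n≡0⇒n≡0 (rowcount s w) e)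
  where
  word-avoids : ∀ w → rowcount s w ≡ 0 → All (λ x → x ≢ s) w
  word-avoids []      e = []
  word-avoids (x ∷ w) e with x ≡ᵇ s in eq
  ... | false = ≡ᵇ-false-sound x s eq ∷ word-avoids w e

-- Vectors read as 1-indexed functions.
entry : ∀ {n} → Vec ℕ n → ℕ → ℕ
entry v s = at (toList v) s

vec-ext : ∀ {n} (x y : Vec ℕ n) → (∀ s → 1 ≤ s → s ≤ n → entry x s ≡ entry y s) → x ≡ y
vec-ext []      []      h = refl
vec-ext (a ∷ x) (b ∷ y) h = cong₂ _∷_ (h 1 (s≤s z≤n) (s≤s z≤n))
  (vec-ext x y (λ { (suc s) l u → h (suc (suc s)) (s≤s z≤n) (s≤s u) }))

entry-lookup : ∀ {n} (a : Vec ℕ n) (p : Fin n) → entry a (suc (toℕ p)) ≡ lookup a p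
entry-lookup (x ∷ a) zero    = refl
entry-lookup (x ∷ a) (suc p) = entry-lookup a p

entry-lookup-ℕ : ∀ {n} (a : Vec ℕ n) k (k<n : k < n) → entry a (suc k) ≡ lookup a (fromℕ< k<n)
entry-lookup-ℕ a k k<n = trans (cong (λ z → entry a (suc z)) (sym (Fin.toℕ-fromℕ< k<n))) (entry-lookup a _)

eqVecᵇ-sound : ∀ {n} (x y : Vec ℕ n) → eqVecᵇ x y ≡ true → x ≡ y
eqVecᵇ-sound []      []      e = refl
eqVecᵇ-sound (a ∷ x) (b ∷ y) e = cong₂ _∷_ (≡ᵇ-sound a b (∧-left (a ≡ᵇ b) e)) (eqVecᵇ-sound x y (∧-right (a ≡ᵇ b) e))

eqVecᵇ-refl : ∀ {n} (x : Vec ℕ n) → eqVecᵇ x x ≡ true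
eqVecᵇ-refl []      = refl
eqVecᵇ-refl (a ∷ x) rewrite ≡ᵇ-refl a = eqVecᵇ-refl x

eqVecᵇ-complete : ∀ {n} {x y : Vec ℕ n} → x ≡ y → eqVecᵇ x y ≡ true
eqVecᵇ-complete {x = x} refl = eqVecᵇ-refl x

entry-wt : ∀ n T s → 1 ≤ s → s ≤ n → entry (wt n T) s ≡ countRow T s
entry-wt n T s l u = go n (countRow T) s l u
  where
  go : ∀ n (g : ℕ → ℕ) s → 1 ≤ s → s ≤ n → entry (tabulate {n = n} (λ r → g (suc (toℕ r)))) s ≡ g s
  go (suc n) g (suc zero)    l u       = refl
  go (suc n) g (suc (suc s)) l (s≤s u) = go n (λ z → g (suc z)) (suc s) (s≤s z≤n) u

keyCoeff≡cnt : ∀ {n} (a : Vec ℕ n) e →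
  keyCoeff a e ≡ cnt (λ T → isKKT n (toList a) T ∧ eqVecᵇ (wt n T) e) (fillings n (toList a))
keyCoeff≡cnt {n} a e = length-filter-filter (isKKT n (toList a)) (λ T → eqVecᵇ (wt n T) e) (fillings n (toList a))

keyCoeff-vanishes : ∀ {n} (a : Vec ℕ n) e →
  (∀ T → Shape n (toList a) T → isKKT n (toList a) T ≡ true → wt n T ≡ e → ⊥) → keyCoeff a e ≡ 0
keyCoeff-vanishes {n} a e none = begin
  keyCoeff a e                                  ≡⟨ keyCoeff≡cnt a e ⟩
  cnt (λ T → isKKT n as T ∧ eqVecᵇ (wt n T) e) (fillings n as)
    ≡⟨ cnt-cong-All _ (λ _ → false) never (fillings n as) (fillings-shape n as) ⟩
  cnt (λ _ → false) (fillings n as)             ≡⟨ cnt-false (fillings n as) ⟩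
  0                                             ∎
  where
  open ≡-Reasoning
  as = toList a
  never : ∀ T → Shape n as T → (isKKT n as T ∧ eqVecᵇ (wt n T) e) ≡ false
  never T s with isKKT n as T in k | eqVecᵇ (wt n T) e in w
  ... | false | _     = refl
  ... | true  | false = refl
  ... | true  | true  = ⊥-elim (none T s k (eqVecᵇ-sound (wt n T) e w))

keyCoeff-positive : ∀ {n} (a : Vec ℕ n) T → Shape n (toList a) T → isKKT n (toList a) T ≡ true →
  1 ≤ keyCoeff a (wt n T)
keyCoeff-positive {n} a T s k = subst (1 ≤_) (sym (keyCoeff≡cnt a (wt n T)))
  (cnt-pos (λ T' → isKKT n (toList a) T' ∧ eqVecᵇ (wt n T') (wt n T)) (fillings n (toList a))
    (∈-fillings n (toList a) T s) (∧-intro k (eqVecᵇ-refl (wt n T))))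

module Conditions (n : ℕ) (as : List ℕ) (T : Filling) where

  kkt-cond1 : isKKT n as T ≡ true → distinctCells n as T ≡ true
  kkt-cond1 k = ∧-left (distinctCells n as T) k

  kkt-cond2 : isKKT n as T ≡ true → cond2 n as T ≡ true
  kkt-cond2 k = ∧-left (cond2 n as T) (∧-right (distinctCells n as T) k)

  kkt-cond3 : isKKT n as T ≡ true → cond3 n as T ≡ true
  kkt-cond3 k = ∧-left (cond3 n as T) (∧-right (cond2 n as T) (∧-right (distinctCells n as T) k))

  kkt-cond4 : isKKT n as T ≡ true → cond4 n as T ≡ true
  kkt-cond4 k = ∧-right (cond3 n as T) (∧-right (cond2 n as T) (∧-right (distinctCells n as T) k))

  kkt-intro : distinctCells n as T ≡ true → cond2 n as T ≡ true → cond3 n as T ≡ true → cond4 n as T ≡ true →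
    isKKT n as T ≡ true
  kkt-intro e1 e2 e3 e4 = ∧-intro e1 (∧-intro e2 (∧-intro e3 e4))

  distinct-cells : distinctCells n as T ≡ true → ∀ i j c → 1 ≤ i → i ≤ n → 1 ≤ j → j ≤ n → i ≢ j →
    1 ≤ c → c ≤ at as i → cell T i c ≢ cell T j c
  distinct-cells e i j c li ui lj uj i≢j lc uc
    with ∨-elim (i ≡ᵇ j) (allB-range-elim n _ (allB-range-elim n _ e i li ui) j lj uj)
  ... | inj₁ i≡j = ⊥-elim (i≢j (≡ᵇ-sound i j i≡j))
  ... | inj₂ h   = ≡ᵇ-false-sound _ _ (not-sound _ (allB-range-elim (at as i) _ h c lc uc))

  label-bound : cond2 n as T ≡ true → ∀ i c → 1 ≤ i → i ≤ n → 1 ≤ c → c ≤ at as i → cell T i c ≤ i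
  label-bound e i c li ui lc uc =
    ≤ᵇ-sound _ _ (allB-range-elim (at as i) _ (allB-range-elim n _ e i li ui) c lc uc)

  label-bound-intro : (∀ i c → 1 ≤ i → i ≤ n → 1 ≤ c → c ≤ at as i → cell T i c ≤ i) → cond2 n as T ≡ true
  label-bound-intro h = allB-range-intro n _ (λ i li ui →
    allB-range-intro (at as i) _ (λ c lc uc → ≤ᵇ-complete (h i c li ui lc uc)))

  descending : cond3 n as T ≡ true → ∀ i c → 1 ≤ i → i ≤ n → 1 ≤ c → c ≤ at as i ∸ 1 → cell T i (suc c) ≤ cell T i c
  descending e i c li ui lc uc =
    ≤ᵇ-sound _ _ (allB-range-elim (at as i ∸ 1) _ (allB-range-elim n _ e i li ui) c lc uc)

  kohnert-step : cond4 n as T ≡ true → ∀ i j c → 1 ≤ i → i ≤ n → 1 ≤ j → j ≤ n → i < j →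
    1 ≤ c → c ≤ at as i ⊓ at as j → cell T j c < cell T i c → cell T j c < cell T i (suc c)
  kohnert-step e i j c li ui lj uj i<j lc uc below
    with ∨-elim (not (i <ᵇ j)) (allB-range-elim n _ (allB-range-elim n _ e i li ui) j lj uj)
  ... | inj₁ h = ⊥-elim (true≢false (trans (sym (<ᵇ-complete i<j)) (not-sound _ h)))
  ... | inj₂ h with ∨-elim (not (cell T j c <ᵇ cell T i c)) (allB-range-elim (at as i ⊓ at as j) _ h c lc uc)
  ...   | inj₁ h' = ⊥-elim (true≢false (trans (sym (<ᵇ-complete below)) (not-sound _ h')))
  ...   | inj₂ h' = <ᵇ-sound _ _ h'

τ : ℕ → ℕ → ℕ
τ r x = if x ≡ᵇ r then suc r else (if x ≡ᵇ suc r then r else x)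

σ : ℕ → Filling → Filling
σ r T = map (map (τ r)) T

τ-r : ∀ r → τ r r ≡ suc r
τ-r r rewrite ≡ᵇ-refl r = refl

τ-sr : ∀ r → τ r (suc r) ≡ r
τ-sr r rewrite ≡ᵇ-false (suc r) r 1+n≢n | ≡ᵇ-refl r = refl

τ-other : ∀ r x → x ≢ r → x ≢ suc r → τ r x ≡ x
τ-other r x x≢r x≢sr rewrite ≡ᵇ-false x r x≢r | ≡ᵇ-false x (suc r) x≢sr = refl

τ-below : ∀ r x → x < r → τ r x ≡ x
τ-below r x x<r = τ-other r x (<⇒≢ x<r) (<⇒≢ (<-trans x<r (n<1+n r)))

data τView (r x : ℕ) : Set where
  is-r     : x ≡ r → τView r x
  is-sr    : x ≡ suc r → τView r x
  is-other : x ≢ r → x ≢ suc r → τView r x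

τview : ∀ r x → τView r x
τview r x with x ≟ r | x ≟ suc r
... | yes e | _     = is-r e
... | no _  | yes e = is-sr e
... | no a  | no b  = is-other a b

τ-involutive : ∀ r x → τ r (τ r x) ≡ x
τ-involutive r x with τview r x
... | is-r refl      rewrite τ-r r = τ-sr r
... | is-sr refl     rewrite τ-sr r = τ-r r
... | is-other a b   rewrite τ-other r x a b = τ-other r x a b

τ-injective : ∀ r {x y} → τ r x ≡ τ r y → x ≡ y
τ-injective r {x} {y} e = trans (sym (τ-involutive r x)) (trans (cong (τ r) e) (τ-involutive r y))

τ-≡ᵇ : ∀ r x y → (τ r x ≡ᵇ τ r y) ≡ (x ≡ᵇ y)
τ-≡ᵇ r x y = bool-ext
  (λ e → subst (λ z → (x ≡ᵇ z) ≡ true) (τ-injective r (≡ᵇ-sound (τ r x) (τ r y) e)) (≡ᵇ-refl x))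
  (λ e → subst (λ z → (τ r x ≡ᵇ τ r z) ≡ true) (≡ᵇ-sound x y e) (≡ᵇ-refl (τ r x)))

τ-<ᵇ : ∀ r x y → x ≢ suc r → y ≢ suc r → (τ r x <ᵇ τ r y) ≡ (x <ᵇ y)
τ-<ᵇ r x y nx ny with τview r x | τview r y
... | is-sr e | _ = ⊥-elim (nx e)
... | _ | is-sr e = ⊥-elim (ny e)
... | is-r refl | is-r refl rewrite τ-r r = refl
... | is-r refl | is-other b1 b2 rewrite τ-r r | τ-other r y b1 b2 =
  bool-ext (λ e → <ᵇ-complete (<-trans (n<1+n r) (<ᵇ-sound (suc r) y e)))
           (λ e → <ᵇ-complete (≤∧≢⇒< (<ᵇ-sound r y e) (λ q → b2 (sym q))))
... | is-other a1 a2 | is-r refl rewrite τ-r r | τ-other r x a1 a2 =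
  bool-ext (λ e → <ᵇ-complete (≤∧≢⇒< (s≤s⁻¹ (<ᵇ-sound x (suc r) e)) a1))
           (λ e → <ᵇ-complete (<-trans (<ᵇ-sound x r e) (n<1+n r)))
... | is-other a1 a2 | is-other b1 b2 rewrite τ-other r x a1 a2 | τ-other r y b1 b2 = refl

τ-≤ᵇ : ∀ r x y → x ≢ suc r → y ≢ suc r → (τ r x ≤ᵇ' τ r y) ≡ (x ≤ᵇ' y)
τ-≤ᵇ r x y nx ny = trans (<ᵇ-suc (τ r x) (τ r y)) (trans (cong not (τ-<ᵇ r y x ny nx)) (sym (<ᵇ-suc x y)))
  where
  <ᵇ-suc : ∀ a b → (a <ᵇ suc b) ≡ not (b <ᵇ a)
  <ᵇ-suc zero    zero    = refl
  <ᵇ-suc zero    (suc b) = refl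
  <ᵇ-suc (suc a) zero    = refl
  <ᵇ-suc (suc a) (suc b) = <ᵇ-suc a b

τ-increasing : ∀ r x → x ≢ suc r → x ≤ τ r x
τ-increasing r x nx with τview r x
... | is-r refl    rewrite τ-r r = n≤1+n r
... | is-sr e      = ⊥-elim (nx e)
... | is-other a b rewrite τ-other r x a b = ≤-refl

τ-range : ∀ r n → 1 ≤ r → suc r ≤ n → ∀ s → 1 ≤ s → s ≤ n → 1 ≤ τ r s × τ r s ≤ n
τ-range r n r≥1 r<n s l u with τview r s
... | is-r refl    rewrite τ-r r = s≤s z≤n , r<n
... | is-sr refl   rewrite τ-sr r = r≥1 , ≤-trans (n≤1+n r) r<n
... | is-other a b rewrite τ-other r s a b = l , u

τ-inversion : ∀ r i j → i < j → τ r j < τ r i → i ≡ r × j ≡ suc r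
τ-inversion r i j i<j lt with τview r i | τview r j
... | is-r refl | is-r refl = ⊥-elim (<-irrefl refl i<j)
... | is-r refl | is-sr refl = refl , refl
... | is-r refl | is-other b1 b2 rewrite τ-r r | τ-other r j b1 b2 = ⊥-elim (<⇒≱ i<j (s≤s⁻¹ lt))
... | is-sr refl | is-r refl = ⊥-elim (<⇒≱ i<j (n≤1+n r))
... | is-sr refl | is-sr refl = ⊥-elim (<-irrefl refl i<j)
... | is-sr refl | is-other b1 b2 rewrite τ-sr r | τ-other r j b1 b2 = ⊥-elim (<⇒≱ lt (≤-trans (n≤1+n r) (<⇒≤ i<j)))
... | is-other a1 a2 | is-r refl rewrite τ-r r | τ-other r i a1 a2 = ⊥-elim (<⇒≱ lt (≤-trans (<⇒≤ i<j) (n≤1+n r)))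
... | is-other a1 a2 | is-sr refl rewrite τ-sr r | τ-other r i a1 a2 = ⊥-elim (<⇒≱ lt (s≤s⁻¹ i<j))
... | is-other a1 a2 | is-other b1 b2 rewrite τ-other r i a1 a2 | τ-other r j b1 b2 = ⊥-elim (<⇒≱ lt (<⇒≤ i<j))

τ-suc : ∀ r s → τ (suc r) (suc s) ≡ suc (τ r s)
τ-suc r s with s ≡ᵇ r
... | true = refl
... | false with s ≡ᵇ suc r
...   | true  = refl
...   | false = refl

τ-positive : ∀ r s → 1 ≤ r → Σ ℕ λ m → τ r (suc s) ≡ suc m
τ-positive (suc r) s _ with τview (suc r) (suc s)
... | is-r q       = suc r , trans (cong (τ (suc r)) q) (τ-r (suc r))
... | is-sr q      = r , trans (cong (τ (suc r)) q) (τ-sr (suc r))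
... | is-other a b = s , τ-other (suc r) (suc s) a b

cell-σ : ∀ r → 1 ≤ r → ∀ T i c → cell (σ r T) i c ≡ τ r (cell T i c)
cell-σ (suc r) _ T i c rewrite atL≡nth (σ (suc r) T) i | nth-map (map (τ (suc r))) [] T i
  | at≡nth (map (τ (suc r)) (nth [] T i)) c | nth-map (τ (suc r)) 0 (nth [] T i) c
  | sym (atL≡nth T i) | sym (at≡nth (atL T i) c) = refl

countRow-σ : ∀ r T s → countRow (σ r T) s ≡ countRow T (τ r s)
countRow-σ r []      s = refl
countRow-σ r (w ∷ T) s = cong₂ _+_ row (countRow-σ r T s)
  where
  row : rowcount s (map (τ r) w) ≡ rowcount (τ r s) w
  row = begin
    rowcount s (map (τ r) w)              ≡⟨ length-filter (_≡ᵇ s) (map (τ r) w) ⟩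
    cnt (_≡ᵇ s) (map (τ r) w)             ≡⟨ cnt-map (_≡ᵇ s) (τ r) w ⟩
    cnt (λ x → τ r x ≡ᵇ s) w              ≡⟨ cnt-cong _ _ (λ x → trans (cong (τ r x ≡ᵇ_) (sym (τ-involutive r s))) (τ-≡ᵇ r x (τ r s))) w ⟩
    cnt (_≡ᵇ τ r s) w                     ≡⟨ sym (length-filter (_≡ᵇ τ r s) w) ⟩
    rowcount (τ r s) w                    ∎
    where open ≡-Reasoning

-- σ r permutes the list of all fillings, because τ r permutes [1, n].

_⊗_ : ∀ {C : Set} → List C → List (List C) → List (List C)
X ⊗ Y = concatMap (λ x → map (x ∷_) Y) X

concatMap-↭ : ∀ {A B : Set} (f : A → List B) {xs ys} → xs ↭ ys → concatMap f xs ↭ concatMap f ys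
concatMap-↭ f Perm.refl        = ↭-refl
concatMap-↭ f (prep x p)       = ↭.++⁺ˡ (f x) (concatMap-↭ f p)
concatMap-↭ f (swap x y p)     = ↭-trans (↭.shifts (f x) (f y)) (↭.++⁺ˡ (f y) (↭.++⁺ˡ (f x) (concatMap-↭ f p)))
concatMap-↭ f (Perm.trans p q) = ↭-trans (concatMap-↭ f p) (concatMap-↭ f q)

⊗-↭ : ∀ {C : Set} (h : C → C) (X : List C) (Y : List (List C)) → map h X ↭ X → map (map h) Y ↭ Y →
  map (map h) (X ⊗ Y) ↭ X ⊗ Y
⊗-↭ h X Y pX pY = begin
  map (map h) (X ⊗ Y)                       ≡⟨ List.map-concatMap (map h) (λ x → map (x ∷_) Y) X ⟩
  concatMap (λ x → map (map h) (map (x ∷_) Y)) X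
    ↭⟨ concatMap-pointwise X ⟩
  concatMap (λ x → map (h x ∷_) Y) X        ≡⟨ List.concatMap-map (λ x → map (x ∷_) Y) h X ⟨
  concatMap (λ x → map (x ∷_) Y) (map h X)  ↭⟨ concatMap-↭ (λ x → map (x ∷_) Y) pX ⟩
  X ⊗ Y                                     ∎
  where
  open Perm.PermutationReasoning
  step : ∀ x → map (map h) (map (x ∷_) Y) ↭ map (h x ∷_) Y
  step x = ↭-trans (↭-reflexive (trans (sym (List.map-∘ Y)) (List.map-∘ Y))) (↭.map⁺ (h x ∷_) pY)
  concatMap-pointwise : ∀ xs → concatMap (λ x → map (map h) (map (x ∷_) Y)) xs ↭ concatMap (λ x → map (h x ∷_) Y) xs
  concatMap-pointwise []       = ↭-refl
  concatMap-pointwise (x ∷ xs) = ↭.++⁺ (step x) (concatMap-pointwise xs)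

module RowSwapPermutes (r : ℕ) (r≥1 : 1 ≤ r) where

  private
    fixes : ∀ lo k → suc r < lo → map (τ r) (interval lo k) ≡ interval lo k
    fixes lo zero    _ = refl
    fixes lo (suc k) l = cong₂ _∷_
      (τ-other r lo (λ e → <⇒≢ (<-trans (n<1+n r) l) (sym e)) (λ e → <⇒≢ l (sym e)))
      (fixes (suc lo) k (<-trans l (n<1+n lo)))

    permutes-interval : ∀ lo k → lo ≤ r → suc r < lo + k → map (τ r) (interval lo k) ↭ interval lo k
    permutes-interval lo zero l u = ⊥-elim (<⇒≱ u (subst (_≤ suc r) (sym (+-identityʳ lo)) (≤-trans l (n≤1+n r))))
    permutes-interval lo (suc k) l u with m≤n⇒m<n∨m≡n l
    ... | inj₁ lt = subst (λ z → z ∷ map (τ r) (interval (suc lo) k) ↭ lo ∷ interval (suc lo) k)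
                      (sym (τ-below r lo lt))
                      (prep lo (permutes-interval (suc lo) k lt (subst (suc r <_) (+-suc lo k) u)))
    permutes-interval lo (suc zero)    l u | inj₂ refl = ⊥-elim (<⇒≱ u (≤-reflexive (+-comm lo 1)))
    permutes-interval lo (suc (suc k)) l u | inj₂ refl
      rewrite τ-r lo | τ-sr lo | fixes (suc (suc lo)) k (n<1+n (suc lo)) = swap (suc lo) lo ↭-refl

  permutes-range : ∀ n → suc r ≤ n → map (τ r) (range n) ↭ range n
  permutes-range n u rewrite range≡interval n = permutes-interval 1 n r≥1 (s≤s u)

  permutes-words : ∀ n k → suc r ≤ n → map (map (τ r)) (words n k) ↭ words n k
  permutes-words n zero    u = ↭-refl
  permutes-words n (suc k) u = ⊗-↭ (τ r) (range n) (words n k) (permutes-range n u) (permutes-words n k u)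

  permutes-fillings : ∀ n as → suc r ≤ n → map (σ r) (fillings n as) ↭ fillings n as
  permutes-fillings n []       u = ↭-refl
  permutes-fillings n (a ∷ as) u =
    ⊗-↭ (map (τ r)) (words n a) (fillings n as) (permutes-words n a u) (permutes-fillings n as u)

-- In a key Kohnert tableau, if i < j and a_i ≤ a_j, the cell labeled j is never
-- strictly below the cell labeled i in the same column: by condition (4) it would
-- also be below the next cell labeled i, and by (3) the argument propagates to
-- column a_i + 1, where there is no cell labeled i.
module _ (n : ℕ) (as : List ℕ) (T : Filling) (s : Shape n as T)
         (e3 : cond3 n as T ≡ true) (e4 : cond4 n as T ≡ true) where
  open Conditions n as T

  no-inversion-below : ∀ i j → 1 ≤ i → i < j → j ≤ n → at as i ≤ at as j →
    ∀ c → 1 ≤ c → c ≤ at as i → cell T j c < cell T i c → ⊥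
  no-inversion-below i j li i<j uj ai≤aj c lc uc = go (at as i ∸ c) c (m∸n+n≡m uc) lc
    where
    go : ∀ k c → k + c ≡ at as i → 1 ≤ c → cell T j c < cell T i c → ⊥
    go k c k+c≡ai lc below with kohnert-step e4 i j c li (≤-trans (<⇒≤ i<j) uj) (≤-trans li (<⇒≤ i<j)) uj i<j lc
             (subst (c ≤_) (sym (m≤n⇒m⊓n≡m ai≤aj)) (subst (c ≤_) k+c≡ai (m≤n+m c k))) below
    go zero    c refl       lc below | next rewrite cell-beyond s i (suc c) ≤-refl = n≮0 next
    go (suc k) c k+c≡ai     lc below | next =
      go k (suc c) (trans (+-suc k c) k+c≡ai) (s≤s z≤n)
        (≤-<-trans (descending e3 j c (≤-trans li (<⇒≤ i<j)) uj lc (∸-monoˡ-≤ 1 (≤-trans c<ai ai≤aj))) next)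
      where
      c<ai : suc c ≤ at as i
      c<ai = subst (suc c ≤_) (trans (+-suc k c) k+c≡ai) (m≤n+m (suc c) k)

module RowSwap (n : ℕ) (as : List ℕ) (r : ℕ) (r≥1 : 1 ≤ r) (r<n : suc r ≤ n) where

  distinct-σ : ∀ T → distinctCells n as (σ r T) ≡ distinctCells n as T
  distinct-σ T = allB-cong (range n) _ _ λ i → allB-cong (range n) _ _ λ j → cong ((i ≡ᵇ j) ∨_)
    (allB-cong (range (at as i)) _ _ λ c → cong not
      (trans (cong₂ _≡ᵇ_ (cell-σ r r≥1 T i c) (cell-σ r r≥1 T j c)) (τ-≡ᵇ r (cell T i c) (cell T j c))))

  module _ (T : Filling) (empty : ∀ i c → cell T i c ≢ suc r) where

    -- Conditions (3) and (4) only compare rows, and τ r preserves order away from r+1.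
    descending-σ : cond3 n as (σ r T) ≡ cond3 n as T
    descending-σ = allB-cong (range n) _ _ λ i → allB-cong (range (at as i ∸ 1)) _ _ λ c →
      trans (cong₂ _≤ᵇ'_ (cell-σ r r≥1 T i (suc c)) (cell-σ r r≥1 T i c)) (τ-≤ᵇ r _ _ (empty i (suc c)) (empty i c))

    kohnert-σ : cond4 n as (σ r T) ≡ cond4 n as T
    kohnert-σ = allB-cong (range n) _ _ λ i → allB-cong (range n) _ _ λ j → cong (not (i <ᵇ j) ∨_)
      (allB-cong (range (at as i ⊓ at as j)) _ _ λ c → cong₂ _∨_
        (cong not (trans (cong₂ _<ᵇ_ (cell-σ r r≥1 T j c) (cell-σ r r≥1 T i c)) (τ-<ᵇ r _ _ (empty j c) (empty i c))))
        (trans (cong₂ _<ᵇ_ (cell-σ r r≥1 T j c) (cell-σ r r≥1 T i (suc c))) (τ-<ᵇ r _ _ (empty j c) (empty i (suc c)))))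

    -- Condition (2) passes from σ r T to T since τ r only raises rows not equal to r+1 ...
    label-bound-σ⁻¹ : cond2 n as (σ r T) ≡ true → cond2 n as T ≡ true
    label-bound-σ⁻¹ e = Conditions.label-bound-intro n as T λ i c li ui lc uc →
      ≤-trans (τ-increasing r (cell T i c) (empty i c))
              (subst (_≤ i) (cell-σ r r≥1 T i c) (Conditions.label-bound n as (σ r T) e i c li ui lc uc))

    -- ... and from T to σ r T as long as no cell labeled r lies in row r.
    label-bound-σ : (∀ c → 1 ≤ c → c ≤ at as r → cell T r c ≢ r) → cond2 n as T ≡ true → cond2 n as (σ r T) ≡ true
    label-bound-σ no-r e = Conditions.label-bound-intro n as (σ r T) λ i c li ui lc uc →
      subst (_≤ i) (sym (cell-σ r r≥1 T i c)) (raised i c lc uc (Conditions.label-bound n as T e i c li ui lc uc))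
      where
      raised : ∀ i c → 1 ≤ c → c ≤ at as i → cell T i c ≤ i → τ r (cell T i c) ≤ i
      raised i c lc uc le with τview r (cell T i c)
      ... | is-r q = subst (_≤ i) (sym (trans (cong (τ r) q) (τ-r r)))
                       (≤∧≢⇒< (subst (_≤ i) q le) λ r≡i → no-r c lc (subst (λ z → c ≤ at as z) (sym r≡i) uc)
                                                                       (subst (λ z → cell T z c ≡ r) (sym r≡i) q))
      ... | is-sr q      = ⊥-elim (empty i c q)
      ... | is-other a b rewrite τ-other r _ a b = le

    -- If a_r ≤ a_{r+1} and row r+1 is empty, no cell labeled r lies in row r: the cell
    -- labeled r+1 in that column would lie strictly below it.
    no-r-in-row-r : Shape n as T → isKKT n as T ≡ true → at as r ≤ at as (suc r) →
      ∀ c → 1 ≤ c → c ≤ at as r → cell T r c ≢ r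
    no-r-in-row-r s kkt ar≤ c lc uc cell≡r =
      no-inversion-below n as T s e3 e4 r (suc r) r≥1 (n<1+n r) r<n ar≤ c lc uc (subst (y <_) (sym cell≡r) y<r)
      where
      open Conditions n as T
      e1 = kkt-cond1 kkt
      e2 = kkt-cond2 kkt
      e3 = kkt-cond3 kkt
      e4 = kkt-cond4 kkt
      y = cell T (suc r) c
      y≤sr : y ≤ suc r
      y≤sr = Conditions.label-bound n as T e2 (suc r) c (s≤s z≤n) r<n lc (≤-trans uc ar≤)
      y≢r : y ≢ r
      y≢r y≡r = Conditions.distinct-cells n as T e1 r (suc r) c r≥1 (≤-trans (n≤1+n r) r<n) (s≤s z≤n) r<n
                  (λ e → 1+n≢n (sym e)) lc uc (trans cell≡r (sym y≡r))
      y<r : y < r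
      y<r = ≤∧≢⇒< (s≤s⁻¹ (≤∧≢⇒< y≤sr (empty (suc r) c))) y≢r

    isKKT-σ : Shape n as T → at as r ≤ at as (suc r) → isKKT n as (σ r T) ≡ isKKT n as T
    isKKT-σ s ar≤ = bool-ext backward forward
      where
      open Conditions
      backward : isKKT n as (σ r T) ≡ true → isKKT n as T ≡ true
      backward k = kkt-intro n as T (trans (sym (distinct-σ T)) (kkt-cond1 n as (σ r T) k))
        (label-bound-σ⁻¹ (kkt-cond2 n as (σ r T) k))
        (trans (sym descending-σ) (kkt-cond3 n as (σ r T) k)) (trans (sym kohnert-σ) (kkt-cond4 n as (σ r T) k))
      forward : isKKT n as T ≡ true → isKKT n as (σ r T) ≡ true
      forward k = kkt-intro n as (σ r T) (trans (distinct-σ T) (kkt-cond1 n as T k))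
        (label-bound-σ (no-r-in-row-r s k ar≤) (kkt-cond2 n as T k))
        (trans descending-σ (kkt-cond3 n as T k)) (trans kohnert-σ (kkt-cond4 n as T k))

  module _ (u v : Vec ℕ n) (v≡uτ : ∀ s → entry v s ≡ entry u (τ r s)) where

    entry-wt-σ : ∀ T s → 1 ≤ s → s ≤ n → entry (wt n (σ r T)) s ≡ entry (wt n T) (τ r s)
    entry-wt-σ T s l h = trans (entry-wt n (σ r T) s l h) (trans (countRow-σ r T s)
      (sym (entry-wt n T (τ r s) (proj₁ (τ-range r n r≥1 r<n s l h)) (proj₂ (τ-range r n r≥1 r<n s l h)))))

    wt-σ : ∀ T → (wt n (σ r T) ≡ u) ⇔ (wt n T ≡ v)
    wt-σ T = mk⇔
      (λ w≡u → vec-ext (wt n T) v λ s l h → begin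
        entry (wt n T) s                   ≡⟨ cong (entry (wt n T)) (sym (τ-involutive r s)) ⟩
        entry (wt n T) (τ r (τ r s))       ≡⟨ sym (entry-wt-σ T (τ r s) (proj₁ (τ-range r n r≥1 r<n s l h)) (proj₂ (τ-range r n r≥1 r<n s l h))) ⟩
        entry (wt n (σ r T)) (τ r s)       ≡⟨ cong (λ z → entry z (τ r s)) w≡u ⟩
        entry u (τ r s)                    ≡⟨ sym (v≡uτ s) ⟩
        entry v s                          ∎)
      (λ w≡v → vec-ext (wt n (σ r T)) u λ s l h → begin
        entry (wt n (σ r T)) s             ≡⟨ entry-wt-σ T s l h ⟩
        entry (wt n T) (τ r s)             ≡⟨ cong (λ z → entry z (τ r s)) w≡v ⟩
        entry v (τ r s)                    ≡⟨ v≡uτ (τ r s) ⟩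
        entry u (τ r (τ r s))              ≡⟨ cong (entry u) (τ-involutive r s) ⟩
        entry u s                          ∎)
      where open ≡-Reasoning

    eqVecᵇ-wt-σ : ∀ T → eqVecᵇ (wt n (σ r T)) u ≡ eqVecᵇ (wt n T) v
    eqVecᵇ-wt-σ T = bool-ext
      (λ e → eqVecᵇ-complete (Equivalence.to (wt-σ T) (eqVecᵇ-sound _ _ e)))
      (λ e → eqVecᵇ-complete (Equivalence.from (wt-σ T) (eqVecᵇ-sound _ _ e)))

    row-empty : entry u r ≡ 0 → ∀ T → wt n T ≡ v → ∀ i c → cell T i c ≢ suc r
    row-empty u-r T w≡v = all-cell {λ x → x ≢ suc r} T (λ ()) (empty-row T (suc r) count≡0)
      where
      count≡0 : countRow T (suc r) ≡ 0
      count≡0 = begin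
        countRow T (suc r)          ≡⟨ sym (entry-wt n T (suc r) (s≤s z≤n) r<n) ⟩
        entry (wt n T) (suc r)      ≡⟨ cong (λ z → entry z (suc r)) w≡v ⟩
        entry v (suc r)             ≡⟨ v≡uτ (suc r) ⟩
        entry u (τ r (suc r))       ≡⟨ cong (entry u) (τ-sr r) ⟩
        entry u r                   ≡⟨ u-r ⟩
        0                           ∎
        where open ≡-Reasoning

    -- Counting argument: σ r permutes the fillings and matches tableaux of
    -- weight u with tableaux of weight v.
    count-σ : entry u r ≡ 0 → at as r ≤ at as (suc r) →
      cnt (λ T → isKKT n as T ∧ eqVecᵇ (wt n T) u) (fillings n as) ≡ cnt (λ T → isKKT n as T ∧ eqVecᵇ (wt n T) v) (fillings n as)
    count-σ u-r ar≤ = begin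
      cnt (λ T → isKKT n as T ∧ eqVecᵇ (wt n T) u) (fillings n as)
        ≡⟨ sym (cnt-↭ _ (RowSwapPermutes.permutes-fillings r r≥1 n as r<n)) ⟩
      cnt (λ T → isKKT n as T ∧ eqVecᵇ (wt n T) u) (map (σ r) (fillings n as))
        ≡⟨ cnt-map _ (σ r) (fillings n as) ⟩
      cnt (λ T → isKKT n as (σ r T) ∧ eqVecᵇ (wt n (σ r T)) u) (fillings n as)
        ≡⟨ cnt-cong-All _ _ matched (fillings n as) (fillings-shape n as) ⟩
      cnt (λ T → isKKT n as T ∧ eqVecᵇ (wt n T) v) (fillings n as) ∎
      where
      open ≡-Reasoning
      matched : ∀ T → Shape n as T → (isKKT n as (σ r T) ∧ eqVecᵇ (wt n (σ r T)) u) ≡ (isKKT n as T ∧ eqVecᵇ (wt n T) v)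
      matched T s rewrite eqVecᵇ-wt-σ T with eqVecᵇ (wt n T) v in w
      ... | true  = cong (_∧ true) (isKKT-σ T (row-empty u-r T (eqVecᵇ-sound _ _ w)) s ar≤)
      ... | false = trans (∧-zeroʳ (isKKT n as (σ r T))) (sym (∧-zeroʳ (isKKT n as T)))

zero-shift-position : ∀ {n} {u v : Vec ℕ n} → ZeroShift u v →
  Σ ℕ λ r → 1 ≤ r × suc r ≤ n × entry u r ≡ 0 × (∀ s → entry v s ≡ entry u (τ r s))
zero-shift-position (here y t) = 1 , s≤s z≤n , s≤s (s≤s z≤n) , refl , swapped
  where
  swapped : ∀ s → entry (y ∷ 0 ∷ t) s ≡ entry (0 ∷ y ∷ t) (τ 1 s)
  swapped zero                = refl
  swapped (suc zero)          = refl
  swapped (suc (suc zero))    = refl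
  swapped (suc (suc (suc s))) = refl
zero-shift-position {suc n} {x ∷ u} {x ∷ v} (there x shift) with zero-shift-position shift
... | suc r , _ , r<n , u-r , v≡uτ = suc (suc r) , s≤s z≤n , s≤s r<n , u-r , shifted
  where
  shifted : ∀ s → entry (x ∷ v) s ≡ entry (x ∷ u) (τ (suc (suc r)) s)
  shifted zero          = refl
  shifted (suc zero)    = refl
  shifted (suc (suc s)) with m , τ≡ ← τ-positive (suc r) s (s≤s z≤n) =
    trans (v≡uτ (suc s)) (trans (cong (entry u) τ≡)
      (cong (entry (x ∷ u)) (sym (trans (τ-suc (suc r) (suc s)) (cong suc τ≡)))))

weakly-increasing-step : ∀ {n} (a : Vec ℕ n) → WeaklyIncreasing a →
  ∀ r → 1 ≤ r → suc r ≤ n → entry a r ≤ entry a (suc r)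
weakly-increasing-step a inc (suc r) _ r<n =
  subst₂ _≤_ (sym (entry-lookup-ℕ a r r'<n)) (sym (entry-lookup-ℕ a (suc r) r<n))
    (inc _ _ (subst₂ _≤_ (sym (Fin.toℕ-fromℕ< r'<n)) (sym (Fin.toℕ-fromℕ< r<n)) (n≤1+n r)))
  where
  r'<n = <-trans (n<1+n r) r<n

weakly-increasing⇒zero-shift-invariant : ∀ {n} (a : Vec ℕ n) → WeaklyIncreasing a → ZeroShiftInvariant n (keyCoeff a)
weakly-increasing⇒zero-shift-invariant {n} a inc u v shift
  with r , r≥1 , r<n , u-r , v≡uτ ← zero-shift-position shift = begin
  keyCoeff a u                                                              ≡⟨ keyCoeff≡cnt a u ⟩
  cnt (λ T → isKKT n (toList a) T ∧ eqVecᵇ (wt n T) u) (fillings n (toList a))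
    ≡⟨ RowSwap.count-σ n (toList a) r r≥1 r<n u v v≡uτ u-r (weakly-increasing-step a inc r r≥1 r<n) ⟩
  cnt (λ T → isKKT n (toList a) T ∧ eqVecᵇ (wt n T) v) (fillings n (toList a)) ≡⟨ sym (keyCoeff≡cnt a v) ⟩
  keyCoeff a v                                                              ∎
  where open ≡-Reasoning

-- (⇐, no zero parts) If every a_i > 0, the cell labeled i in column 1 lies in row i:
-- by (2) it lies in a row x ≤ i, and a row x < i is already occupied by label x.
module FirstColumn (n : ℕ) (as : List ℕ) (positive : ∀ i → 1 ≤ i → i ≤ n → 1 ≤ at as i)
                   (T : Filling) (s : Shape n as T)
                   (e1 : distinctCells n as T ≡ true) (e2 : cond2 n as T ≡ true) where

  first-column : ∀ i → 1 ≤ i → i ≤ n → cell T i 1 ≡ i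
  first-column i = below (suc i) i ≤-refl
    where
    -- strong induction on i, bounded by k
    below : ∀ k i → i < k → 1 ≤ i → i ≤ n → cell T i 1 ≡ i
    below (suc k) i (s≤s i≤k) li ui with m≤n⇒m<n∨m≡n (Conditions.label-bound n as T e2 i 1 li ui ≤-refl (positive i li ui))
    ... | inj₂ x≡i = x≡i
    ... | inj₁ x<i = ⊥-elim (Conditions.distinct-cells n as T e1 i x 1 li ui lx (≤-trans (<⇒≤ x<i) ui)
                       (λ q → <⇒≢ x<i (sym q)) ≤-refl (positive i li ui)
                       (sym (below k x (<-≤-trans x<i i≤k) lx (≤-trans (<⇒≤ x<i) ui))))
      where
      x = cell T i 1
      lx : 1 ≤ x
      lx = proj₁ (cell-range s i 1 ≤-refl (positive i li ui))

  rows-nonempty : ∀ i → 1 ≤ i → i ≤ n → countRow T i ≢ 0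
  rows-nonempty i li ui empty =
    all-cell {λ x → x ≢ i} T (<⇒≢ li) (empty-row T i empty) i 1 (first-column i li ui)

no-zero-parts⇒vanishing-on-zeros : ∀ {n} (a : Vec ℕ n) → NoZeroParts a → ∀ e → HasZero e → keyCoeff a e ≡ 0
no-zero-parts⇒vanishing-on-zeros {n} a nz e (p , e-p≡0) = keyCoeff-vanishes a e λ T s kkt w≡e →
  FirstColumn.rows-nonempty n (toList a) positive T s (Conditions.kkt-cond1 n (toList a) T kkt)
    (Conditions.kkt-cond2 n (toList a) T kkt)
    (suc (toℕ p)) (s≤s z≤n) (Fin.toℕ<n p)
    (begin
      countRow T (suc (toℕ p))       ≡⟨ sym (entry-wt n T (suc (toℕ p)) (s≤s z≤n) (Fin.toℕ<n p)) ⟩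
      entry (wt n T) (suc (toℕ p))   ≡⟨ cong (λ z → entry z (suc (toℕ p))) w≡e ⟩
      entry e (suc (toℕ p))          ≡⟨ entry-lookup e p ⟩
      lookup e p                     ≡⟨ e-p≡0 ⟩
      0                              ∎)
  where
  open ≡-Reasoning
  positive : ∀ i → 1 ≤ i → i ≤ n → 1 ≤ at (toList a) i
  positive (suc i) _ i<n = subst (1 ≤_) (sym (entry-lookup-ℕ a i i<n)) (nz _)

sufficiency : ∀ n (a : Vec ℕ n) → NoZeroParts a ⊎ WeaklyIncreasing a → IsQuasisymmetric n (keyCoeff a)
sufficiency n a (inj₁ nz)  = compression-invariant⇒quasisymmetric n (keyCoeff a)
  (vanishing-on-zeros⇒compression-invariant n (keyCoeff a) (no-zero-parts⇒vanishing-on-zeros a nz))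
sufficiency n a (inj₂ inc) = compression-invariant⇒quasisymmetric n (keyCoeff a)
  (zero-shift⇒compression-invariant n (keyCoeff a) (weakly-increasing⇒zero-shift-invariant a inc))

-- Dominance: in a filling satisfying (2) the cells labeled 1..q all lie in rows
-- 1..q, so the first q row counts of the weight dominate a_1 + ⋯ + a_q.

rows-up-to : ∀ q w → All (1 ≤_) w → Σ[ interval 1 q ] (λ s → rowcount s w) ≡ cnt (_≤ᵇ' q) w
rows-up-to q []      []         = Σ-zero _ (interval 1 q) (All.universal (λ _ → refl) (interval 1 q))
rows-up-to q (x ∷ w) (x≥1 ∷ w≥1) = begin
  Σ[ interval 1 q ] (λ s → rowcount s (x ∷ w))
    ≡⟨ Σ-cong _ _ (interval 1 q) (λ s → rowcount-cons s x w) ⟩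
  Σ[ interval 1 q ] (λ s → ind (x ≡ᵇ s) + rowcount s w)
    ≡⟨ Σ-+ (λ s → ind (x ≡ᵇ s)) (λ s → rowcount s w) (interval 1 q) ⟩
  Σ[ interval 1 q ] (λ s → ind (x ≡ᵇ s)) + Σ[ interval 1 q ] (λ s → rowcount s w)
    ≡⟨ cong₂ _+_ indicator (rows-up-to q w w≥1) ⟩
  ind (x ≤ᵇ' q) + cnt (_≤ᵇ' q) w
    ≡⟨ sym (cnt-cons (_≤ᵇ' q) x w) ⟩
  cnt (_≤ᵇ' q) (x ∷ w) ∎
  where
  open ≡-Reasoning
  other-rows : ∀ s → x ≢ s → ind (x ≡ᵇ s) ≡ 0
  other-rows s x≢s rewrite ≡ᵇ-false x s x≢s = refl
  indicator : Σ[ interval 1 q ] (λ s → ind (x ≡ᵇ s)) ≡ ind (x ≤ᵇ' q)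
  indicator with x ≤ᵇ' q in x≤q
  ... | true  = trans (Σ-single 1 q _ x x≥1 (s≤s (≤ᵇ-sound x q x≤q)) (λ s _ _ s≢x → other-rows s (λ e → s≢x (sym e))))
                      (cong ind (≡ᵇ-refl x))
  ... | false = Σ-zero _ (interval 1 q) (All.map (λ { (_ , s≤q) → other-rows _ (λ x≡s →
                  <⇒≱ (≤ᵇ-false-sound x q x≤q) (subst (_≤ q) (sym x≡s) (s≤s⁻¹ s≤q))) }) (all-interval 1 q))

dominance : ∀ n as T → Shape n as T → length as ≡ n → cond2 n as T ≡ true → ∀ q → q ≤ n →
  Σ[ interval 1 q ] (at as) ≤ Σ[ interval 1 q ] (countRow T)
dominance n as T s len e2 q q≤n = begin
  Σ[ interval 1 q ] (at as)
    ≡⟨ Σ-cong-All (at as) low (interval 1 q) (all-interval 1 q) labels-low ⟩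
  Σ[ interval 1 q ] low
    ≤⟨ m≤m+n _ _ ⟩
  Σ[ interval 1 q ] low + Σ[ interval (1 + q) (n ∸ q) ] low
    ≡⟨ sym (Σ-++ low (interval 1 q) (interval (1 + q) (n ∸ q))) ⟩
  Σ[ interval 1 q ++ interval (1 + q) (n ∸ q) ] low
    ≡⟨ cong (λ z → Σ[ z ] low) (trans (sym (interval-++ 1 q (n ∸ q))) (cong (interval 1) (m+[n∸m]≡n q≤n))) ⟩
  Σ[ interval 1 n ] low
    ≡⟨ cong (λ z → Σ[ interval 1 z ] low) (sym (trans (shape-length s) len)) ⟩
  Σ[ interval 1 (length T) ] low
    ≡⟨ sym (Σ-map (cnt (_≤ᵇ' q)) (atL T) (interval 1 (length T))) ⟩
  Σ[ map (atL T) (interval 1 (length T)) ] (cnt (_≤ᵇ' q))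
    ≡⟨ cong (λ z → Σ[ z ] (cnt (_≤ᵇ' q))) (sym T≡tabulated) ⟩
  Σ[ T ] (cnt (_≤ᵇ' q))
    ≡⟨ sym (Σ-cong-All _ _ T (shape-valid s) (λ w v → rows-up-to q w (All.map proj₁ v))) ⟩
  Σ[ T ] (λ w → Σ[ interval 1 q ] (λ s → rowcount s w))
    ≡⟨ sym (Σ-swap rowcount (interval 1 q) T) ⟩
  Σ[ interval 1 q ] (countRow T) ∎
  where
  open ≤-Reasoning
  low : ℕ → ℕ
  low i = cnt (_≤ᵇ' q) (atL T i)
  T≡tabulated : T ≡ map (atL T) (interval 1 (length T))
  T≡tabulated = trans (list≡tabulated [] T) (List.map-cong (λ i → sym (atL≡nth T i)) (interval 1 (length T)))
  -- for i ≤ q every cell labeled i is in a row ≤ i ≤ q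
  labels-low : ∀ i → 1 ≤ i × i < 1 + q → at as i ≡ low i
  labels-low i (li , ui) = sym (trans (cnt-all _ (atL T i) (row-low (atL T i) λ c lc uc →
      ≤ᵇ-complete (≤-trans (Conditions.label-bound n as T e2 i c li (≤-trans (s≤s⁻¹ ui) q≤n) lc
                              (subst (c ≤_) (shape-row-length s i) uc)) (s≤s⁻¹ ui))))
    (shape-row-length s i))
    where
    row-low : ∀ {P : ℕ → Set} w → (∀ c → 1 ≤ c → c ≤ length w → P (at w c)) → All P w
    row-low []      h = []
    row-low (x ∷ w) h = h 1 ≤-refl (s≤s z≤n) ∷ row-low w (λ { (suc c) l u → h (suc (suc c)) (s≤s z≤n) (s≤s u) })

-- Vanishing: if a_{q+1} < a_q, no tableau has weight s_q·a (a with parts q, q+1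
-- exchanged), because the first q row counts of s_q·a sum to less than a_1 + ⋯ + a_q.
vanishing-at-descent : ∀ {n} (a : Vec ℕ n) q → 1 ≤ q → suc q ≤ n → entry a (suc q) < entry a q →
  ∀ e → (∀ s → 1 ≤ s → s ≤ n → entry e s ≡ entry a (τ q s)) → keyCoeff a e ≡ 0
vanishing-at-descent {n} a (suc p) _ q<n descent e e≡aτ = keyCoeff-vanishes a e λ T s kkt w≡e →
  <⇒≱ descent (+-cancelˡ-≤ (Σ[ interval 1 p ] A) _ _ (begin
    Σ[ interval 1 p ] A + A q     ≡⟨ sym (split A) ⟩
    Σ[ interval 1 q ] A           ≤⟨ dominance n (toList a) T s (length-toList a) (Conditions.kkt-cond2 n (toList a) T kkt) q (<⇒≤ q<n) ⟩
    Σ[ interval 1 q ] (countRow T) ≡⟨ weight-prefix T w≡e ⟩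
    Σ[ interval 1 p ] A + A (suc q) ∎))
  where
  open ≤-Reasoning
  q = suc p
  A = at (toList a)
  split : ∀ (g : ℕ → ℕ) → Σ[ interval 1 q ] g ≡ Σ[ interval 1 p ] g + g q
  split g = trans (cong (λ z → Σ[ z ] g) (trans (cong (interval 1) (+-comm 1 p)) (interval-++ 1 p 1)))
                  (trans (Σ-++ g (interval 1 p) [ q ]) (cong (Σ[ interval 1 p ] g +_) (+-identityʳ (g q))))
  weight-prefix : ∀ T → wt n T ≡ e → Σ[ interval 1 q ] (countRow T) ≡ Σ[ interval 1 p ] A + A (suc q)
  weight-prefix T w≡e = trans
    (Σ-cong-All (countRow T) (λ s → A (τ q s)) (interval 1 q) (all-interval 1 q) (λ s (l , u) →
      let s≤n = ≤-trans (s≤s⁻¹ u) (≤-trans (n≤1+n q) q<n) in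
      trans (sym (entry-wt n T s l s≤n)) (trans (cong (λ z → entry z s) w≡e) (e≡aτ s l s≤n))))
    (trans (split (λ s → A (τ q s)))
      (cong₂ _+_ (Σ-cong-All (λ s → A (τ q s)) A (interval 1 p) (all-interval 1 p)
                   (λ s (_ , u) → cong A (τ-below q s u)))
                 (cong A (τ-r q))))

-- Constant-row tableaux: given a permutation ρ of [1, n] (inverse π) with ρ i ≤ i
-- and "ρ j < ρ i, i < j ⇒ a_j < a_i" on the nonzero parts, placing every cell
-- labeled i in row ρ i gives a key Kohnert tableau of weight s ↦ a_{π s}.
module ConstantRows {n : ℕ} (a : Vec ℕ n) (ρ π : ℕ → ℕ)
  (ρ-range : ∀ i → 1 ≤ i → i ≤ n → 1 ≤ ρ i × ρ i ≤ n)
  (π-range : ∀ s → 1 ≤ s → s ≤ n → 1 ≤ π s × π s ≤ n)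
  (πρ : ∀ i → 1 ≤ i → i ≤ n → π (ρ i) ≡ i)
  (ρπ : ∀ s → 1 ≤ s → s ≤ n → ρ (π s) ≡ s)
  (ρ-lowers : ∀ i → 1 ≤ i → i ≤ n → 1 ≤ entry a i → ρ i ≤ i)
  (ρ-inversions : ∀ i j → 1 ≤ i → i < j → j ≤ n → 1 ≤ entry a i → 1 ≤ entry a j → ρ j < ρ i → entry a j < entry a i)
  where

  private
    as = toList a
    A = at as

  Tρ : Filling
  Tρ = map (λ i → List.replicate (A i) (ρ i)) (interval 1 n)

  private
    row : ∀ i → 1 ≤ i → i ≤ n → atL Tρ i ≡ List.replicate (A i) (ρ i)
    row i l u = trans (atL≡nth Tρ i) (nth-map-interval [] (λ i → List.replicate (A i) (ρ i)) n i l u)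

    at-replicate : ∀ k v c → 1 ≤ c → c ≤ k → at (List.replicate k v) c ≡ v
    at-replicate (suc k) v (suc zero)    l u       = refl
    at-replicate (suc k) v (suc (suc c)) l (s≤s u) = at-replicate k v (suc c) (s≤s z≤n) u

  shape : Shape n as Tρ
  shape = shape-intro n as Tρ (trans (List.length-map _ (interval 1 n)) (trans (length-interval 1 n) (sym (length-toList a))))
    λ i l u → let u' = subst (i ≤_) (length-toList a) u in
      subst (λ z → length z ≡ A i × ValidWord n z) (sym (row i l u'))
        (List.length-replicate (A i) , All.replicate⁺ (A i) (ρ-range i l u'))

  cell-inside : ∀ i c → 1 ≤ i → i ≤ n → 1 ≤ c → c ≤ A i → cell Tρ i c ≡ ρ i
  cell-inside i c l u lc uc rewrite row i l u = at-replicate (A i) (ρ i) c lc uc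

  private
    cell-cases : ∀ i c → 1 ≤ i → i ≤ n → 1 ≤ c → cell Tρ i c ≡ ρ i ⊎ cell Tρ i c ≡ 0
    cell-cases i c l u lc with c ≤? A i
    ... | yes uc = inj₁ (cell-inside i c l u lc uc)
    ... | no nc  = inj₂ (cell-beyond shape i c (≰⇒> nc))

    ρ-injective : ∀ i j → 1 ≤ i → i ≤ n → 1 ≤ j → j ≤ n → ρ i ≡ ρ j → i ≡ j
    ρ-injective i j li ui lj uj e = trans (sym (πρ i li ui)) (trans (cong π e) (πρ j lj uj))

  distinct : distinctCells n as Tρ ≡ true
  distinct = allB-range-intro n _ λ i li ui → allB-range-intro n _ λ j lj uj → pair i j li ui lj uj
    where
    pair : ∀ i j → 1 ≤ i → i ≤ n → 1 ≤ j → j ≤ n →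
      ((i ≡ᵇ j) ∨ allB (range (A i)) (λ c → not (cell Tρ i c ≡ᵇ cell Tρ j c))) ≡ true
    pair i j li ui lj uj with i ≡ᵇ j in i≢j
    ... | true  = refl
    ... | false = allB-range-intro (A i) _ λ c lc uc → cong not (≡ᵇ-false _ _ (apart c lc uc))
      where
      apart : ∀ c → 1 ≤ c → c ≤ A i → cell Tρ i c ≢ cell Tρ j c
      apart c lc uc e with cell-cases j c lj uj lc
      ... | inj₁ q = ≡ᵇ-false-sound i j i≢j (ρ-injective i j li ui lj uj (trans (sym (cell-inside i c li ui lc uc)) (trans e q)))
      ... | inj₂ q = <⇒≢ (proj₁ (ρ-range i li ui)) (sym (trans (sym (cell-inside i c li ui lc uc)) (trans e q)))

  label-bound : cond2 n as Tρ ≡ true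
  label-bound = Conditions.label-bound-intro n as Tρ λ i c li ui lc uc →
    subst (_≤ i) (sym (cell-inside i c li ui lc uc)) (ρ-lowers i li ui (≤-trans lc uc))

  descending : cond3 n as Tρ ≡ true
  descending = allB-range-intro n _ λ i li ui → allB-range-intro (A i ∸ 1) _ λ c lc uc →
    ≤ᵇ-complete (≤-reflexive (trans (cell-inside i (suc c) li ui (s≤s z≤n) (next (A i) lc uc))
                                    (sym (cell-inside i c li ui lc (≤-trans (n≤1+n c) (next (A i) lc uc))))))
    where
    next : ∀ {c} m → 1 ≤ c → c ≤ m ∸ 1 → suc c ≤ m
    next (suc m) _         c≤m = s≤s c≤m
    next zero    (s≤s z≤n) ()

  kohnert : cond4 n as Tρ ≡ true
  kohnert = allB-range-intro n _ λ i li ui → allB-range-intro n _ λ j lj uj → pair i j li ui lj uj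
    where
    pair : ∀ i j → 1 ≤ i → i ≤ n → 1 ≤ j → j ≤ n →
      (not (i <ᵇ j) ∨ allB (range (A i ⊓ A j)) (λ c → not (cell Tρ j c <ᵇ cell Tρ i c) ∨ (cell Tρ j c <ᵇ cell Tρ i (suc c)))) ≡ true
    pair i j li ui lj uj with i <ᵇ j in i<j
    ... | false = refl
    ... | true  = allB-range-intro (A i ⊓ A j) _ column
      where
      column : ∀ c → 1 ≤ c → c ≤ A i ⊓ A j → (not (cell Tρ j c <ᵇ cell Tρ i c) ∨ (cell Tρ j c <ᵇ cell Tρ i (suc c))) ≡ true
      column c lc uc with cell Tρ j c <ᵇ cell Tρ i c in below
      ... | false = refl
      ... | true  = <ᵇ-complete (subst₂ _<_ (sym cj) (sym ci') ρj<ρi)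
        where
        uci = ≤-trans uc (m⊓n≤m (A i) (A j))
        ucj = ≤-trans uc (m⊓n≤n (A i) (A j))
        cj  = cell-inside j c lj uj lc ucj
        ρj<ρi : ρ j < ρ i
        ρj<ρi = subst₂ _<_ cj (cell-inside i c li ui lc uci) (<ᵇ-sound _ _ below)
        -- a_j < a_i, so label i still has a cell in column c+1
        aj<ai : A j < A i
        aj<ai = ρ-inversions i j li (<ᵇ-sound i j i<j) uj (≤-trans lc uci) (≤-trans lc ucj) ρj<ρi
        ci' = cell-inside i (suc c) li ui (s≤s z≤n) (≤-trans (s≤s ucj) aj<ai)

  isKKT-Tρ : isKKT n as Tρ ≡ true
  isKKT-Tρ = Conditions.kkt-intro n as Tρ distinct label-bound descending kohnert

  entry-weight : ∀ s → 1 ≤ s → s ≤ n → entry (wt n Tρ) s ≡ A (π s)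
  entry-weight s l u = begin
    entry (wt n Tρ) s                                               ≡⟨ entry-wt n Tρ s l u ⟩
    Σ[ Tρ ] (rowcount s)                                            ≡⟨ Σ-map (rowcount s) _ (interval 1 n) ⟩
    Σ[ interval 1 n ] (λ i → rowcount s (List.replicate (A i) (ρ i))) ≡⟨ Σ-single 1 n _ (π s) (proj₁ (π-range s l u)) (s≤s (proj₂ (π-range s l u))) elsewhere ⟩
    rowcount s (List.replicate (A (π s)) (ρ (π s)))                 ≡⟨ cong (λ z → rowcount s (List.replicate (A (π s)) z)) (ρπ s l u) ⟩
    rowcount s (List.replicate (A (π s)) s)                         ≡⟨ count-own (A (π s)) ⟩
    A (π s)                                                         ∎
    where
    open ≡-Reasoning
    count-own : ∀ k → rowcount s (List.replicate k s) ≡ k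
    count-own zero    = refl
    count-own (suc k) rewrite ≡ᵇ-refl s = cong suc (count-own k)
    count-other : ∀ k v → v ≢ s → rowcount s (List.replicate k v) ≡ 0
    count-other zero    v v≢s = refl
    count-other (suc k) v v≢s rewrite ≡ᵇ-false v s v≢s = count-other k v v≢s
    elsewhere : ∀ i → 1 ≤ i → i < 1 + n → i ≢ π s → rowcount s (List.replicate (A i) (ρ i)) ≡ 0
    elsewhere i li ui i≢πs = count-other (A i) (ρ i) λ e → i≢πs (trans (sym (πρ i li (s≤s⁻¹ ui))) (cong π e))

  coefficient-positive : 1 ≤ keyCoeff a (wt n Tρ)
  coefficient-positive = keyCoeff-positive a Tρ shape isKKT-Tρ

swapAt : ∀ {n} → Vec ℕ n → ℕ → Vec ℕ n
swapAt []            r             = []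
swapAt (x ∷ [])      r             = x ∷ []
swapAt (x ∷ y ∷ t)   zero          = x ∷ y ∷ t
swapAt (x ∷ y ∷ t)   (suc zero)    = y ∷ x ∷ t
swapAt (x ∷ y ∷ t)   (suc (suc r)) = x ∷ swapAt (y ∷ t) (suc r)

entry-swapAt : ∀ {n} (v : Vec ℕ n) r → 1 ≤ r → suc r ≤ n → ∀ s → entry (swapAt v r) s ≡ entry v (τ r s)
entry-swapAt []          (suc r)       _ ()        s
entry-swapAt (x ∷ [])    (suc r)       _ (s≤s ())  s
entry-swapAt (x ∷ y ∷ t) (suc zero)    _ _ zero                = refl
entry-swapAt (x ∷ y ∷ t) (suc zero)    _ _ (suc zero)          = refl
entry-swapAt (x ∷ y ∷ t) (suc zero)    _ _ (suc (suc zero))    = refl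
entry-swapAt (x ∷ y ∷ t) (suc zero)    _ _ (suc (suc (suc s))) = refl
entry-swapAt (x ∷ y ∷ t) (suc (suc r)) _ _ zero                = refl
entry-swapAt (x ∷ y ∷ t) (suc (suc r)) _ _ (suc zero)          = refl
entry-swapAt (x ∷ y ∷ t) (suc (suc r)) _ (s≤s r<n) (suc (suc s)) with m , τ≡ ← τ-positive (suc r) s (s≤s z≤n) =
  trans (entry-swapAt (y ∷ t) (suc r) (s≤s z≤n) r<n (suc s))
    (trans (cong (entry (y ∷ t)) τ≡) (cong (entry (x ∷ y ∷ t)) (sym (trans (τ-suc (suc r) (suc s)) (cong suc τ≡)))))

compress-swapAt : ∀ {n} (v : Vec ℕ n) r → 1 ≤ r → suc r ≤ n → entry v (suc r) ≡ 0 → compress (swapAt v r) ≡ compress v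
compress-swapAt []                 (suc r)       _ ()        e
compress-swapAt (x ∷ [])           (suc r)       _ (s≤s ())  e
compress-swapAt (zero ∷ zero ∷ t)  (suc zero)    _ _         refl = refl
compress-swapAt (suc x ∷ zero ∷ t) (suc zero)    _ _         refl = refl
compress-swapAt (zero ∷ y ∷ t)     (suc (suc r)) _ (s≤s r<n) e    = compress-swapAt (y ∷ t) (suc r) (s≤s z≤n) r<n e
compress-swapAt (suc x ∷ y ∷ t)    (suc (suc r)) _ (s≤s r<n) e    = cong (suc x ∷_) (compress-swapAt (y ∷ t) (suc r) (s≤s z≤n) r<n e)

-- The entries of w with position p deleted and a zero appended at the end.
deleteAt : ∀ {n} → Vec ℕ n → ℕ → ℕ → ℕ
deleteAt {n} w p s = if s <ᵇ p then entry w s else (if s <ᵇ n then entry w (suc s) else 0)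

compress-cons : ∀ {n m} x (v : Vec ℕ n) (w : Vec ℕ m) → compress v ≡ compress w → compress (x ∷ v) ≡ compress (x ∷ w)
compress-cons zero    v w e = e
compress-cons (suc x) v w e = cong (suc x ∷_) e

compress-snoc-zero : ∀ {m} (v : Vec ℕ (suc m)) (w : Vec ℕ m) → (∀ s → 1 ≤ s → s ≤ m → entry v s ≡ entry w s) →
  entry v (suc m) ≡ 0 → compress v ≡ compress w
compress-snoc-zero {zero}  (zero ∷ []) []      h e = refl
compress-snoc-zero {suc m} (x ∷ v)     (y ∷ w) h e with refl ← h 1 ≤-refl (s≤s z≤n) =
  compress-cons x v w (compress-snoc-zero v w (λ { (suc s) l u → h (suc (suc s)) (s≤s z≤n) (s≤s u) }) e)

compress-deleteAt : ∀ {n} (v w : Vec ℕ n) p → 1 ≤ p → p ≤ n → entry w p ≡ 0 →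
  (∀ s → 1 ≤ s → s ≤ n → entry v s ≡ deleteAt w p s) → compress v ≡ compress w
compress-deleteAt {suc n} v (y ∷ w) (suc zero) _ _ refl h =
  compress-snoc-zero v w (λ s l u → trans (h s l (≤-trans u (n≤1+n n))) (shifted s l u))
    (trans (h (suc n) (s≤s z≤n) ≤-refl) last)
  where
  shifted : ∀ s → 1 ≤ s → s ≤ n → deleteAt (0 ∷ w) 1 s ≡ entry w s
  shifted (suc s) _ u rewrite <ᵇ-complete {suc s} {suc n} (s≤s u) = refl
  last : deleteAt (0 ∷ w) 1 (suc n) ≡ 0
  last rewrite <ᵇ-false {suc n} {suc n} ≤-refl = refl
compress-deleteAt {suc n} (x ∷ v) (y ∷ w) (suc (suc p)) _ (s≤s p≤n) w-p h with refl ← h 1 (s≤s z≤n) (s≤s z≤n) =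
  compress-cons x v w (compress-deleteAt v w (suc p) (s≤s z≤n) p≤n w-p (λ { (suc s) l u → h (suc (suc s)) (s≤s z≤n) (s≤s u) }))

-- The permutation of [1, n] that moves p to the end and shifts p+1..n down by one
-- (squeeze), and its inverse (unsqueeze).
module Squeeze (n p : ℕ) (p≥1 : 1 ≤ p) (p≤n : p ≤ n) where

  squeeze : ℕ → ℕ
  squeeze i = if i <ᵇ p then i else (if i ≡ᵇ p then n else i ∸ 1)

  unsqueeze : ℕ → ℕ
  unsqueeze s = if s <ᵇ p then s else (if s <ᵇ n then suc s else p)

  squeeze-below : ∀ i → i < p → squeeze i ≡ i
  squeeze-below i i<p rewrite <ᵇ-complete i<p = refl

  squeeze-p : squeeze p ≡ n
  squeeze-p rewrite <ᵇ-false {p} {p} ≤-refl | ≡ᵇ-refl p = refl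

  squeeze-above : ∀ i → p < i → squeeze i ≡ i ∸ 1
  squeeze-above i p<i rewrite <ᵇ-false {i} {p} (<⇒≤ p<i) | ≡ᵇ-false i p (>⇒≢ p<i) = refl

  unsqueeze-below : ∀ s → s < p → unsqueeze s ≡ s
  unsqueeze-below s s<p rewrite <ᵇ-complete s<p = refl

  unsqueeze-middle : ∀ s → p ≤ s → s < n → unsqueeze s ≡ suc s
  unsqueeze-middle s p≤s s<n rewrite <ᵇ-false {s} {p} p≤s | <ᵇ-complete s<n = refl

  unsqueeze-n : unsqueeze n ≡ p
  unsqueeze-n rewrite <ᵇ-false {n} {p} p≤n | <ᵇ-false {n} {n} ≤-refl = refl

  unsqueeze-squeeze : ∀ i → 1 ≤ i → i ≤ n → unsqueeze (squeeze i) ≡ i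
  unsqueeze-squeeze i l u with <-cmp i p
  ... | tri< i<p _ _ rewrite squeeze-below i i<p = unsqueeze-below i i<p
  ... | tri≈ _ refl _ rewrite squeeze-p = unsqueeze-n
  unsqueeze-squeeze (suc i) l u | tri> _ _ p<i rewrite squeeze-above (suc i) p<i = unsqueeze-middle i (s≤s⁻¹ p<i) u

  squeeze-unsqueeze : ∀ s → 1 ≤ s → s ≤ n → squeeze (unsqueeze s) ≡ s
  squeeze-unsqueeze s l u with <-cmp s p | m≤n⇒m<n∨m≡n u
  ... | tri< s<p _ _ | _       rewrite unsqueeze-below s s<p = squeeze-below s s<p
  ... | tri≈ _ s≡p _  | inj₁ s<n rewrite unsqueeze-middle s (≤-reflexive (sym s≡p)) s<n = squeeze-above (suc s) (s≤s (≤-reflexive (sym s≡p)))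
  ... | tri> _ _ p<s  | inj₁ s<n rewrite unsqueeze-middle s (<⇒≤ p<s) s<n = squeeze-above (suc s) (<-trans p<s (n<1+n s))
  ... | tri≈ _ _ _    | inj₂ refl rewrite unsqueeze-n = squeeze-p
  ... | tri> _ _ _    | inj₂ refl rewrite unsqueeze-n = squeeze-p

  squeeze-range : ∀ i → 1 ≤ i → i ≤ n → 1 ≤ squeeze i × squeeze i ≤ n
  squeeze-range i l u with <-cmp i p
  ... | tri< i<p _ _ rewrite squeeze-below i i<p = l , u
  ... | tri≈ _ refl _ rewrite squeeze-p = ≤-trans p≥1 p≤n , ≤-refl
  squeeze-range (suc i) l u | tri> _ _ p<i rewrite squeeze-above (suc i) p<i = ≤-trans p≥1 (s≤s⁻¹ p<i) , ≤-trans (n≤1+n i) u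

  unsqueeze-range : ∀ s → 1 ≤ s → s ≤ n → 1 ≤ unsqueeze s × unsqueeze s ≤ n
  unsqueeze-range s l u with <-cmp s p | m≤n⇒m<n∨m≡n u
  ... | tri< s<p _ _ | _        rewrite unsqueeze-below s s<p = l , u
  ... | tri≈ _ s≡p _ | inj₁ s<n rewrite unsqueeze-middle s (≤-reflexive (sym s≡p)) s<n = s≤s z≤n , s<n
  ... | tri> _ _ p<s | inj₁ s<n rewrite unsqueeze-middle s (<⇒≤ p<s) s<n = s≤s z≤n , s<n
  ... | tri≈ _ _ _   | inj₂ refl rewrite unsqueeze-n = p≥1 , p≤n
  ... | tri> _ _ _   | inj₂ refl rewrite unsqueeze-n = p≥1 , p≤n

  squeeze-monotone : ∀ x y → x < y → x ≢ p → y ≢ p → squeeze x < squeeze y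
  squeeze-monotone x y x<y x≢p y≢p with <-cmp x p | <-cmp y p
  ... | tri≈ _ e _ | _ = ⊥-elim (x≢p e)
  ... | _ | tri≈ _ e _ = ⊥-elim (y≢p e)
  ... | tri< x<p _ _ | tri< y<p _ _ rewrite squeeze-below x x<p | squeeze-below y y<p = x<y
  squeeze-monotone x (suc y) x<y x≢p y≢p | tri< x<p _ _ | tri> _ _ p<y
    rewrite squeeze-below x x<p | squeeze-above (suc y) p<y = <-≤-trans x<p (s≤s⁻¹ p<y)
  ... | tri> _ _ p<x | tri< y<p _ _ = ⊥-elim (<-asym (<-trans p<x x<y) y<p)
  squeeze-monotone (suc x) (suc y) x<y x≢p y≢p | tri> _ _ p<x | tri> _ _ p<y
    rewrite squeeze-above (suc x) p<x | squeeze-above (suc y) p<y = s≤s⁻¹ x<y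

  squeeze-lowers : ∀ x → x ≢ p → squeeze x ≤ x
  squeeze-lowers x x≢p with <-cmp x p
  ... | tri< x<p _ _ rewrite squeeze-below x x<p = ≤-refl
  ... | tri≈ _ e _   = ⊥-elim (x≢p e)
  squeeze-lowers (suc x) x≢p | tri> _ _ p<x rewrite squeeze-above (suc x) p<x = n≤1+n x

crossing : ∀ {P : ℕ → Set} → (∀ t → Dec (P t)) → ∀ m k → P m → ¬ P (m + k) →
  Σ ℕ λ t → m ≤ t × t < m + k × P t × ¬ P (suc t)
crossing {P} P? m zero    pm ¬end = ⊥-elim (¬end (subst P (sym (+-identityʳ m)) pm))
crossing {P} P? m (suc k) pm ¬end with P? (suc m)
... | no ¬next = m , ≤-refl , lo<lo+suc m k , pm , ¬next
... | yes next with crossing P? (suc m) k next (λ p → ¬end (subst P (sym (+-suc m k)) p))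
...   | t , m<t , t<end , pt , ¬pt = t , <⇒≤ m<t , <-shift m k t<end , pt , ¬pt

module NoZeroAndDescent {n : ℕ} (a : Vec ℕ n) (invariant : CompressionInvariant n (keyCoeff a)) where

  private
    A = entry a

    -- Both cases: a tableau whose weight compresses like s_q·a, where a_{q+1} < a_q.
    refute : ∀ q → 1 ≤ q → suc q ≤ n → A (suc q) < A q → ∀ w → 1 ≤ keyCoeff a w →
      compress w ≡ compress (swapAt a q) → ⊥
    refute q q≥1 q<n descent w positive same = <⇒≢ (≤-trans positive (≤-reflexive (begin
      keyCoeff a w             ≡⟨ invariant w (swapAt a q) same ⟩
      keyCoeff a (swapAt a q)  ≡⟨ vanishing-at-descent a q q≥1 q<n descent (swapAt a q) (λ s _ _ → entry-swapAt a q q≥1 q<n s) ⟩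
      0                        ∎))) refl
      where open ≡-Reasoning

  -- Case a_t > 0 = a_{t+1}: the tableau with every label i in row i has weight a.
  positive-before-zero : ∀ t → 1 ≤ t → suc t ≤ n → 0 < A t → A (suc t) ≡ 0 → ⊥
  positive-before-zero t t≥1 t<n a-t a-st =
    refute t t≥1 t<n (subst (_< A t) (sym a-st) a-t) (wt n Tρ) coefficient-positive
      (trans (cong compress weight≡a) (sym (compress-swapAt a t t≥1 t<n a-st)))
    where
    open ConstantRows a (λ i → i) (λ i → i) (λ i l u → l , u) (λ i l u → l , u) (λ _ _ _ → refl) (λ _ _ _ → refl)
           (λ _ _ _ _ → ≤-refl) (λ i j _ i<j _ _ _ j<i → ⊥-elim (<-asym i<j j<i))
    weight≡a : wt n Tρ ≡ a
    weight≡a = vec-ext (wt n Tρ) a entry-weight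

  -- Case a_p = 0 with p < q: put label i in row squeeze (τ q i), i.e. exchange
  -- q, q+1 and then close the gap left by the empty label p.
  zero-before-descent : ∀ p q → 1 ≤ p → p < q → suc q ≤ n → A p ≡ 0 → A (suc q) < A q → ⊥
  zero-before-descent p q p≥1 p<q q<n a-p descent =
    refute q q≥1 q<n descent (wt n Tρ) coefficient-positive
      (compress-deleteAt (wt n Tρ) (swapAt a q) p p≥1 p≤n swapped-p weight-deletes)
    where
    p≤n : p ≤ n
    p≤n = ≤-trans (<⇒≤ p<q) (≤-trans (n≤1+n q) q<n)
    q≥1 : 1 ≤ q
    q≥1 = ≤-trans p≥1 (<⇒≤ p<q)
    open Squeeze n p p≥1 p≤n
    τ-range-q = τ-range q n q≥1 q<n
    τq-p : τ q p ≡ p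
    τq-p = τ-below q p p<q
    nonzero≢p : ∀ i → 1 ≤ A i → i ≢ p
    nonzero≢p i l i≡p = <⇒≢ l (sym (trans (cong A i≡p) a-p))

    ρ π : ℕ → ℕ
    ρ i = squeeze (τ q i)
    π s = τ q (unsqueeze s)

    ρ-lowers : ∀ i → 1 ≤ i → i ≤ n → 1 ≤ A i → ρ i ≤ i
    ρ-lowers i l u a-i with τview q i
    ... | is-r refl    rewrite τ-r q | squeeze-above (suc q) (<-trans p<q (n<1+n q)) = ≤-refl
    ... | is-sr refl   rewrite τ-sr q = ≤-trans (squeeze-lowers q (>⇒≢ p<q)) (n≤1+n q)
    ... | is-other x y rewrite τ-other q i x y = squeeze-lowers i (nonzero≢p i a-i)

    -- The only inversion of ρ among nonzero parts is (q, q+1), where a_{q+1} < a_q.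
    ρ-inversions : ∀ i j → 1 ≤ i → i < j → j ≤ n → 1 ≤ A i → 1 ≤ A j → ρ j < ρ i → A j < A i
    ρ-inversions i j _ i<j _ a-i a-j ρj<ρi with <-cmp (τ q i) (τ q j)
    ... | tri< τi<τj _ _ = ⊥-elim (<-asym ρj<ρi (squeeze-monotone (τ q i) (τ q j) τi<τj (τ≢p i a-i) (τ≢p j a-j)))
      where
      τ≢p : ∀ k → 1 ≤ A k → τ q k ≢ p
      τ≢p k a-k e = nonzero≢p k a-k (trans (sym (τ-involutive q k)) (trans (cong (τ q) e) τq-p))
    ... | tri≈ _ e _ = ⊥-elim (<⇒≢ i<j (τ-injective q e))
    ... | tri> _ _ τj<τi with refl , refl ← τ-inversion q i j i<j τj<τi = descent

    open ConstantRows a ρ π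
      (λ i l u → squeeze-range (τ q i) (proj₁ (τ-range-q i l u)) (proj₂ (τ-range-q i l u)))
      (λ s l u → τ-range-q (unsqueeze s) (proj₁ (unsqueeze-range s l u)) (proj₂ (unsqueeze-range s l u)))
      (λ i l u → trans (cong (τ q) (unsqueeze-squeeze (τ q i) (proj₁ (τ-range-q i l u)) (proj₂ (τ-range-q i l u))))
                       (τ-involutive q i))
      (λ s l u → trans (cong squeeze (τ-involutive q (unsqueeze s))) (squeeze-unsqueeze s l u))
      ρ-lowers ρ-inversions

    swapped-p : entry (swapAt a q) p ≡ 0
    swapped-p = trans (entry-swapAt a q q≥1 q<n p) (trans (cong A τq-p) a-p)

    -- The weight of Tρ is s_q·a with its zero at p moved to the end.
    weight-deletes : ∀ s → 1 ≤ s → s ≤ n → entry (wt n Tρ) s ≡ deleteAt (swapAt a q) p s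
    weight-deletes s l u = trans (entry-weight s l u) (by-position s l u)
      where
      by-position : ∀ s → 1 ≤ s → s ≤ n → A (π s) ≡ deleteAt (swapAt a q) p s
      by-position s l u with <-cmp s p | m≤n⇒m<n∨m≡n u
      ... | tri< s<p _ _ | _ rewrite <ᵇ-complete s<p = sym (entry-swapAt a q q≥1 q<n s)
      ... | tri≈ _ refl _ | inj₁ p<n rewrite <ᵇ-false {p} {p} ≤-refl | <ᵇ-complete p<n =
        sym (entry-swapAt a q q≥1 q<n (suc p))
      ... | tri> _ _ p<s | inj₁ s<n rewrite <ᵇ-false {s} {p} (<⇒≤ p<s) | <ᵇ-complete s<n =
        sym (entry-swapAt a q q≥1 q<n (suc s))
      ... | tri≈ _ refl _ | inj₂ refl rewrite unsqueeze-n | <ᵇ-false {p} {p} ≤-refl = trans (cong A τq-p) a-p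
      ... | tri> _ _ p<s | inj₂ refl rewrite unsqueeze-n | <ᵇ-false {s} {p} (<⇒≤ p<s) | <ᵇ-false {s} {s} ≤-refl =
        trans (cong A τq-p) a-p

  -- There are no z, q with a_z = 0 and a_{q+1} < a_q: if z < q use the gap
  -- construction, and if z > q the last positive part before z precedes a zero.
  impossible : ∀ z → 1 ≤ z → z ≤ n → A z ≡ 0 → ∀ q → 1 ≤ q → suc q ≤ n → A (suc q) < A q → ⊥
  impossible z z≥1 z≤end a-z q q≥1 q<n descent with <-cmp z q
  ... | tri< z<q _ _ = zero-before-descent z q z≥1 z<q q<n a-z descent
  ... | tri≈ _ z≡q _ = n≮0 (subst (A (suc q) <_) (trans (cong A (sym z≡q)) a-z) descent)
  ... | tri> _ _ q<z with crossing (λ t → 0 <? A t) q (z ∸ q) (<-≤-trans (s≤s z≤n) descent)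
                            (λ pos → <⇒≢ pos (sym (subst (λ k → A k ≡ 0) (sym (m+[n∸m]≡n (<⇒≤ q<z))) a-z)))
  ...   | t , q≤t , t<z , a-t , ¬a-st =
    positive-before-zero t (≤-trans q≥1 q≤t) (≤-trans (subst (t <_) (m+[n∸m]≡n (<⇒≤ q<z)) t<z) z≤end) a-t (n≤0⇒n≡0 (≮⇒≥ ¬a-st))

zero-part : ∀ {n} (a : Vec ℕ n) → ¬ NoZeroParts a → Σ ℕ λ z → 1 ≤ z × z ≤ n × entry a z ≡ 0
zero-part {n} a ¬nz with p , ¬pos ← Fin.¬∀⟶∃¬ n _ (λ p → 0 <? lookup a p) ¬nz =
  suc (toℕ p) , s≤s z≤n , Fin.toℕ<n p , trans (entry-lookup a p) (n≤0⇒n≡0 (≮⇒≥ ¬pos))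

WeaklyIncreasing? : ∀ {n} (a : Vec ℕ n) → Dec (WeaklyIncreasing a)
WeaklyIncreasing? a = Fin.all? λ p → Fin.all? λ q → (p Fin.≤? q) →-dec (lookup a p ≤? lookup a q)

adjacent-descent-between : ∀ (A : ℕ → ℕ) P Q → P ≤ Q → A Q < A P → Σ ℕ λ t → P ≤ t × suc t ≤ Q × A (suc t) < A t
adjacent-descent-between A P Q P≤Q drop
  with t , P≤t , t<Q , later , ¬later ← crossing (λ t → A Q <? A t) P (Q ∸ P) drop
         (λ later → <-irrefl refl (subst (λ k → A Q < A k) (m+[n∸m]≡n P≤Q) later)) =
  t , P≤t , subst (t <_) (m+[n∸m]≡n P≤Q) t<Q , ≤-<-trans (≮⇒≥ ¬later) later

adjacent-descent : ∀ {n} (a : Vec ℕ n) → ¬ WeaklyIncreasing a →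
  Σ ℕ λ q → 1 ≤ q × suc q ≤ n × entry a (suc q) < entry a q
adjacent-descent {n} a ¬inc
  with p , ¬inc-p ← Fin.¬∀⟶∃¬ n _ (λ p → Fin.all? λ q → (p Fin.≤? q) →-dec (lookup a p ≤? lookup a q)) ¬inc
  with q , ¬inc-pq ← Fin.¬∀⟶∃¬ n _ (λ q → (p Fin.≤? q) →-dec (lookup a p ≤? lookup a q)) ¬inc-p
  with p Fin.≤? q
... | no p≰q  = ⊥-elim (¬inc-pq (λ p≤q → ⊥-elim (p≰q p≤q)))
... | yes p≤q
  with t , P≤t , t<Q , descent ← adjacent-descent-between (entry a) (suc (toℕ p)) (suc (toℕ q)) (s≤s p≤q)
         (subst₂ _<_ (sym (entry-lookup a q)) (sym (entry-lookup a p)) (≰⇒> (λ le → ¬inc-pq (λ _ → le)))) =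
  t , ≤-trans (s≤s z≤n) P≤t , ≤-trans t<Q (Fin.toℕ<n q) , descent

necessity : ∀ n (a : Vec ℕ n) → IsQuasisymmetric n (keyCoeff a) → NoZeroParts a ⊎ WeaklyIncreasing a
necessity n a qsym with Fin.all? (λ p → 0 <? lookup a p) | WeaklyIncreasing? a
... | yes nz  | _        = inj₁ nz
... | no _    | yes inc  = inj₂ inc
... | no ¬nz  | no ¬inc with zero-part a ¬nz | adjacent-descent a ¬inc
...   | z , z≥1 , z≤end , a-z | q , q≥1 , q<n , descent =
  ⊥-elim (NoZeroAndDescent.impossible a (quasisymmetric⇒compression-invariant n (keyCoeff a) qsym)
            z z≥1 z≤end a-z q q≥1 q<n descent)

proposition2p4 : (n : ℕ) (a : Vec ℕ n) →
    IsQuasisymmetric n (keyCoeff a) ⇔ (NoZeroParts a ⊎ WeaklyIncreasing a)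
proposition2p4 n a = mk⇔ (necessity n a) (sufficiency n a)
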